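{- A simple binary matroid is chordal if and only if it does not have $U_{3,4}$ as an induced minor.
   Context: A matroid $M$ is chordal if, for each circuit $C$ of $M$ with at least four elements, there are circuits $C_1,C_2$ and an element $e$ such that $C_1\cap C_2=\{e\}$ and $C=(C_1\cup C_2)-e$. An induced minor of $M$ is a matroid obtainable from $M$ by a sequence of restrictions to flats and contractions, each contraction being followed by simplification. -}

module Defs where

open import Data.Nat using (ℕ; zero; suc; _≤_)
open import Data.Bool using (Bool; true; false; _xor_)
open import Data.Fin using (Fin; zero; suc)
open import Data.Fin.Subset using (Subset; _∈_; _∉_; _⊆_; _∪_; _∩_; _─_; _-_; ⁅_⁆; ∣_∣; ⊥; ∁)
open import Data.Vec using (Vec; []; _∷_; zipWith; replicate)
open import Data.Product using (Σ; ∃; _×_; _,_)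
open import Data.Sum using (_⊎_)
open import Relation.Nullary using (¬_)
open import Relation.Binary.PropositionalEquality using (_≡_; _≢_)

-- Raw matroid data on a ground set E ⊆ Fin n, given by independent sets.
-- (Minors keep the ambient Fin n and shrink E, avoiding relabelling.)

record MData (n : ℕ) : Set₁ where
  constructor mdata
  field
    E     : Subset n
    Indep : Subset n → Set
open MData public

record IsMatroid {n : ℕ} (M : MData n) : Set where
  field
    indep⊆E : ∀ X → Indep M X → X ⊆ E M
    I1      : Indep M ⊥
    I2      : ∀ X Y → Y ⊆ X → Indep M X → Indep M Y
    I3      : ∀ I J → Indep M I → Indep M J → suc ∣ I ∣ ≤ ∣ J ∣ →
              ∃ λ e → e ∈ J × e ∉ I × Indep M (I ∪ ⁅ e ⁆)

module _ {n : ℕ} (M : MData n) where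

  IsCircuit : Subset n → Set
  IsCircuit C = C ⊆ E M × ¬ Indep M C × (∀ x → x ∈ C → Indep M (C - x))

  IsLoop : Fin n → Set
  IsLoop e = e ∈ E M × ¬ Indep M ⁅ e ⁆

  Parallel : Fin n → Fin n → Set
  Parallel e f = e ≢ f × ¬ IsLoop e × ¬ IsLoop f × e ∈ E M × f ∈ E M ×
                 ¬ Indep M (⁅ e ⁆ ∪ ⁅ f ⁆)

  IsSimple : Set
  IsSimple = (∀ e → ¬ IsLoop e) × (∀ e f → ¬ Parallel e f)

  IsFlat : Subset n → Set
  IsFlat F = F ⊆ E M ×
    (∀ C e → IsCircuit C → e ∈ E M → e ∉ F → e ∈ C → ¬ (C ⊆ (F ∪ ⁅ e ⁆)))

  IsBasisOf : Subset n → Subset n → Set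
  IsBasisOf X B = B ⊆ X × Indep M B × (∀ e → e ∈ X → e ∉ B → ¬ Indep M (B ∪ ⁅ e ⁆))

  restrict : Subset n → MData n
  restrict X = mdata X (λ I → I ⊆ X × Indep M I)

  contract : Subset n → MData n
  contract C = mdata (E M ─ C)
    (λ I → I ⊆ (E M ─ C) × ∃ λ B → IsBasisOf C B × Indep M (I ∪ B))

  IsSimplificationSet : Subset n → Set
  IsSimplificationSet S = S ⊆ E M × (∀ e → e ∈ S → ¬ IsLoop e) ×
    (∀ e f → e ∈ S → f ∈ S → ¬ Parallel e f) ×
    (∀ e → e ∈ E M → ¬ IsLoop e → e ∈ S ⊎ (∃ λ f → f ∈ S × Parallel e f))

  IsChordal : Set
  IsChordal = ∀ C → IsCircuit C → 4 ≤ ∣ C ∣ →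
    ∃ λ C₁ → ∃ λ C₂ → ∃ λ e → IsCircuit C₁ × IsCircuit C₂ ×
      (C₁ ∩ C₂) ≡ ⁅ e ⁆ × C ≡ ((C₁ ∪ C₂) - e)

  IsU34 : Set
  IsU34 = ∣ E M ∣ ≡ 4 × (∀ X → X ⊆ E M → (Indep M X → ∣ X ∣ ≤ 3) × (∣ X ∣ ≤ 3 → Indep M X))

-- Binary representability: a map φ from elements to column vectors in
-- GF(2)^r such that X ⊆ E is independent iff {φ e : e ∈ X} is linearly
-- independent over GF(2), i.e. no nonempty subset of X has zero sum
-- (the map is injective on independent sets implicitly via this).

colSum : ∀ {n r} → (Fin n → Vec Bool r) → Subset n → Vec Bool r
colSum {zero}  {r} φ []       = replicate r false
colSum {suc n} φ (false ∷ Y) = colSum (λ i → φ (suc i)) Y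
colSum {suc n} φ (true ∷ Y)  = zipWith _xor_ (φ zero) (colSum (λ i → φ (suc i)) Y)

GF2Independent : ∀ {n r} → (Fin n → Vec Bool r) → Subset n → Set
GF2Independent {n} {r} φ X = ∀ Y → Y ⊆ X → colSum φ Y ≡ replicate r false → Y ≡ ⊥

IsBinary : ∀ {n} → MData n → Set
IsBinary {n} M = ∃ λ (r : ℕ) → ∃ λ (φ : Fin n → Vec Bool r) →
  ∀ X → X ⊆ E M → (Indep M X → GF2Independent φ X) × (GF2Independent φ X → Indep M X)

data InducedMinor {n : ℕ} (M : MData n) : MData n → Set₁ where
  imRefl     : InducedMinor M M
  imRestrict : ∀ {N} → InducedMinor M N → ∀ F → IsFlat N F →
               InducedMinor M (restrict N F)
  imContract : ∀ {N} → InducedMinor M N → ∀ C → C ⊆ E N → ∀ S →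
               IsSimplificationSet (contract N C) S →
               InducedMinor M (restrict (contract N C) S)

{-# OPTIONS --safe #-}

-- Work with a GF(2) representation φ of M: its circuits are exactly the minimal nonempty sets
-- of zero column sum.  A circuit C with |C| ≥ 4 and a chord (an element f ∉ C whose vector is
-- the sum over some Y ⊊ C) splits into the circuits Y + f and (C − Y) + f.  A chordless circuit
-- is a flat, and contracting all but four of its elements, then simplifying, leaves U₃,₄.
-- Conversely, every induced minor N of M is the restriction of M / K to a set E N that is closed
-- in M / K up to loops and parallel elements.  If N is U₃,₄, then E N together with some loops of
-- M / K forms a circuit Z of M; take Z smallest.  Chordality splits Z as C₁ + C₂ − e.  Since e
-- is spanned by E N modulo K, closedness makes it a loop of M / K or parallel to some g ∈ E N;
-- either way C₁ or C₂ is a smaller circuit of the same kind (for E N, or for E N with g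
-- exchanged for e), a contradiction.

module Submission where

open import Defs
open import Data.Nat using (ℕ; zero; suc; _+_; _<_; _≤_; _≤?_; s≤s; z≤n)
open import Data.Nat.Properties using (+-suc; m≤m+n; ≤-refl; ≤-trans; <-≤-trans; n≮n; ≰⇒>)
open import Data.Bool using (Bool; true; false; _xor_)
open import Data.Bool.Properties
  using (xor-assoc; xor-comm; xor-same; xor-identityˡ; xor-identityʳ) renaming (_≟_ to _≟ᵇ_)
open import Data.Fin using (Fin; zero; suc)
open import Data.Fin.Properties using (any?) renaming (_≟_ to _≟ᶠ_)
open import Data.Fin.Subset
  using (Subset; Nonempty; _∈_; _∉_; _⊆_; _∪_; _∩_; _─_; _-_; ⁅_⁆; ∣_∣; ⊥)
open import Data.Fin.Subset.Properties
  using ( _∈?_; _⊆?_; anySubset?; nonempty?; Empty-unique; ∉⊥; ⊆-antisym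
        ; x∈⁅x⁆; x∈⁅y⁆⇒x≡y; x≢y⇒x∉⁅y⁆; ∣⁅x⁆∣≡1; ∣⊥∣≡0; ∣p∣≤n
        ; x∈p∪q⁻; p⊆p∪q; q⊆p∪q; x∈p∩q⁺; x∈p∩q⁻; p∩q⊆p; p∩q⊆q
        ; x∈p∧x∉q⇒x∈p─q; p─q⊆p; x∈p∧x≢y⇒x∈p-y; ∪-identityʳ; s⊆s; p⊆q⇒∣p∣≤∣q∣; p⊂q⇒∣p∣<∣q∣ )
open import Data.Vec using (Vec; []; _∷_; here; there; replicate; zipWith)
open import Data.Vec.Properties
  using (zipWith-assoc; zipWith-comm; zipWith-identityˡ; zipWith-identityʳ; ≡-dec)
open import Data.Product using (∃; _×_; _,_; proj₁; proj₂)
open import Data.Sum using (_⊎_; inj₁; inj₂)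
open import Data.Empty using () renaming (⊥-elim to absurd)
open import Relation.Nullary using (¬_; Dec; yes; no)
open import Relation.Nullary.Decidable using (_×-dec_; ¬?)
open import Relation.Binary.PropositionalEquality
  using (_≡_; _≢_; refl; sym; trans; cong; cong₂; subst; module ≡-Reasoning)
open import Function.Bundles using (_⇔_; mk⇔)

private
  variable
    n r : ℕ

infixl 6 _⊕_
_⊕_ : Vec Bool r → Vec Bool r → Vec Bool r
_⊕_ = zipWith _xor_

𝟘 : Vec Bool r
𝟘 = replicate _ false

⊕-self : (u : Vec Bool r) → u ⊕ u ≡ 𝟘
⊕-self []      = refl
⊕-self (a ∷ u) = cong₂ _∷_ (xor-same a) (⊕-self u)

⊕-assoc : (u v w : Vec Bool r) → (u ⊕ v) ⊕ w ≡ u ⊕ (v ⊕ w)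
⊕-assoc = zipWith-assoc xor-assoc

⊕-comm : (u v : Vec Bool r) → u ⊕ v ≡ v ⊕ u
⊕-comm = zipWith-comm xor-comm

⊕-identityˡ : (u : Vec Bool r) → 𝟘 ⊕ u ≡ u
⊕-identityˡ = zipWith-identityˡ xor-identityˡ

⊕-identityʳ : (u : Vec Bool r) → u ⊕ 𝟘 ≡ u
⊕-identityʳ = zipWith-identityʳ xor-identityʳ

⊕-involutiveˡ : (u v : Vec Bool r) → u ⊕ (u ⊕ v) ≡ v
⊕-involutiveˡ u v = begin
  u ⊕ (u ⊕ v)  ≡⟨ sym (⊕-assoc u u v) ⟩
  (u ⊕ u) ⊕ v  ≡⟨ cong (_⊕ v) (⊕-self u) ⟩
  𝟘 ⊕ v        ≡⟨ ⊕-identityˡ v ⟩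
  v            ∎
  where open ≡-Reasoning

⊕-involutiveʳ : (u v : Vec Bool r) → (v ⊕ u) ⊕ u ≡ v
⊕-involutiveʳ u v = begin
  (v ⊕ u) ⊕ u  ≡⟨ ⊕-comm (v ⊕ u) u ⟩
  u ⊕ (v ⊕ u)  ≡⟨ cong (u ⊕_) (⊕-comm v u) ⟩
  u ⊕ (u ⊕ v)  ≡⟨ ⊕-involutiveˡ u v ⟩
  v            ∎
  where open ≡-Reasoning

⊕-cancel-middle : (u v w : Vec Bool r) → (u ⊕ v) ⊕ (v ⊕ w) ≡ u ⊕ w
⊕-cancel-middle u v w = trans (⊕-assoc u v (v ⊕ w)) (cong (u ⊕_) (⊕-involutiveˡ v w))

⊕-cancel-outer : (u v : Vec Bool r) → (u ⊕ v) ⊕ u ≡ v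
⊕-cancel-outer u v = trans (cong (_⊕ u) (⊕-comm u v)) (⊕-involutiveʳ u v)

⊕≡𝟘⇒≡ : (u v : Vec Bool r) → u ⊕ v ≡ 𝟘 → u ≡ v
⊕≡𝟘⇒≡ u v eq = begin
  u            ≡⟨ sym (⊕-involutiveʳ v u) ⟩
  (u ⊕ v) ⊕ v  ≡⟨ cong (_⊕ v) eq ⟩
  𝟘 ⊕ v        ≡⟨ ⊕-identityˡ v ⟩
  v            ∎
  where open ≡-Reasoning

⊕-left-swap : (u v w : Vec Bool r) → u ⊕ (v ⊕ w) ≡ v ⊕ (u ⊕ w)
⊕-left-swap u v w = begin
  u ⊕ (v ⊕ w)  ≡⟨ sym (⊕-assoc u v w) ⟩
  (u ⊕ v) ⊕ w  ≡⟨ cong (_⊕ w) (⊕-comm u v) ⟩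
  (v ⊕ u) ⊕ w  ≡⟨ ⊕-assoc v u w ⟩
  v ⊕ (u ⊕ w)  ∎
  where open ≡-Reasoning

⊕-absorb-common : (u v w : Vec Bool r) → v ⊕ w ≡ (u ⊕ v) ⊕ (u ⊕ w)
⊕-absorb-common u v w = begin
  v ⊕ w              ≡⟨ sym (⊕-cancel-middle v u w) ⟩
  (v ⊕ u) ⊕ (u ⊕ w)  ≡⟨ cong (_⊕ (u ⊕ w)) (⊕-comm v u) ⟩
  (u ⊕ v) ⊕ (u ⊕ w)  ∎
  where open ≡-Reasoning

_≟ᵛ_ : (u v : Vec Bool r) → Dec (u ≡ v)
_≟ᵛ_ = ≡-dec _≟ᵇ_

-- Finite subsets; on Subset n the operation _⊕_ is symmetric difference

x∈p⊕q⁻ : {x : Fin n} (p q : Subset n) → x ∈ p ⊕ q → (x ∈ p × x ∉ q) ⊎ (x ∉ p × x ∈ q)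
x∈p⊕q⁻ (true  ∷ p) (false ∷ q) here = inj₁ (here , λ ())
x∈p⊕q⁻ (false ∷ p) (true  ∷ q) here = inj₂ ((λ ()) , here)
x∈p⊕q⁻ (_ ∷ p) (_ ∷ q) (there i) with x∈p⊕q⁻ p q i
... | inj₁ (a , b) = inj₁ (there a , λ { (there j) → b j })
... | inj₂ (a , b) = inj₂ ((λ { (there j) → a j }) , there b)

x∈p∧x∉q⇒x∈p⊕q : {x : Fin n} {p q : Subset n} → x ∈ p → x ∉ q → x ∈ p ⊕ q
x∈p∧x∉q⇒x∈p⊕q {q = true  ∷ q} here o = absurd (o here)
x∈p∧x∉q⇒x∈p⊕q {q = false ∷ q} here o = here
x∈p∧x∉q⇒x∈p⊕q {q = _ ∷ q} (there i) o = there (x∈p∧x∉q⇒x∈p⊕q i (λ j → o (there j)))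

x∉p∧x∈q⇒x∈p⊕q : {x : Fin n} {p q : Subset n} → x ∉ p → x ∈ q → x ∈ p ⊕ q
x∉p∧x∈q⇒x∈p⊕q {p = p} {q} o i = subst (_ ∈_) (⊕-comm q p) (x∈p∧x∉q⇒x∈p⊕q i o)

x∈p∩q⇒x∉p⊕q : {x : Fin n} {p q : Subset n} → x ∈ p → x ∈ q → x ∉ p ⊕ q
x∈p∩q⇒x∉p⊕q {p = p} {q} x∈p x∈q i with x∈p⊕q⁻ p q i
... | inj₁ (_ , x∉q) = x∉q x∈q
... | inj₂ (x∉p , _) = x∉p x∈p

x∈p─q⇒x∉q : {x : Fin n} {p q : Subset n} → x ∈ p ─ q → x ∉ q
x∈p─q⇒x∉q {p = _ ∷ p} {true  ∷ q} ()    here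
x∈p─q⇒x∉q {p = _ ∷ p} {_ ∷ q} (there i) (there j) = x∈p─q⇒x∉q i j

x∈p-y⇒x≢y : {x y : Fin n} {p : Subset n} → x ∈ p - y → x ≢ y
x∈p-y⇒x≢y i refl = x∈p─q⇒x∉q i (x∈⁅x⁆ _)

x∉p-x : {x : Fin n} (p : Subset n) → x ∉ p - x
x∉p-x p i = x∈p-y⇒x≢y i refl

∉-everywhere⇒≡⊥ : {p : Subset n} → (∀ {x} → x ∉ p) → p ≡ ⊥
∉-everywhere⇒≡⊥ h = Empty-unique (λ (_ , i) → h i)

≡⊥⊎Nonempty : (p : Subset n) → p ≡ ⊥ ⊎ Nonempty p
≡⊥⊎Nonempty p with nonempty? p
... | yes ne = inj₂ ne
... | no  e  = inj₁ (Empty-unique e)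

⊆⊎∃∉ : (p q : Subset n) → q ⊆ p ⊎ ∃ λ x → x ∈ q × x ∉ p
⊆⊎∃∉ p q with any? (λ x → (x ∈? q) ×-dec ¬? (x ∈? p))
... | yes (x , i , o) = inj₂ (x , i , o)
... | no h = inj₁ q⊆p
  where
  q⊆p : q ⊆ p
  q⊆p {x} i with x ∈? p
  ... | yes j = j
  ... | no  o = absurd (h (x , i , o))

x∈p⇒⁅x⁆⊆p : {x : Fin n} {p : Subset n} → x ∈ p → ⁅ x ⁆ ⊆ p
x∈p⇒⁅x⁆⊆p {x = x} {p} x∈p i = subst (_∈ p) (sym (x∈⁅y⁆⇒x≡y x i)) x∈p

∪-least : {p q s : Subset n} → p ⊆ s → q ⊆ s → p ∪ q ⊆ s
∪-least {p = p} {q} p⊆s q⊆s i with x∈p∪q⁻ p q i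
... | inj₁ a = p⊆s a
... | inj₂ b = q⊆s b

⊕-least : {p q s : Subset n} → p ⊆ s → q ⊆ s → p ⊕ q ⊆ s
⊕-least {p = p} {q} p⊆s q⊆s i with x∈p⊕q⁻ p q i
... | inj₁ (a , _) = p⊆s a
... | inj₂ (_ , b) = q⊆s b

p-x⊆p : {x : Fin n} (p : Subset n) → p - x ⊆ p
p-x⊆p p = p─q⊆p p ⁅ _ ⁆

p∪⁅x⁆≡p⊕⁅x⁆ : {x : Fin n} {p : Subset n} → x ∉ p → p ∪ ⁅ x ⁆ ≡ p ⊕ ⁅ x ⁆
p∪⁅x⁆≡p⊕⁅x⁆ {x = x} {p} x∉p = ⊆-antisym ∪⊆⊕ ⊕⊆∪
  where
  ∪⊆⊕ : p ∪ ⁅ x ⁆ ⊆ p ⊕ ⁅ x ⁆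
  ∪⊆⊕ i with x∈p∪q⁻ p ⁅ x ⁆ i
  ... | inj₁ a = x∈p∧x∉q⇒x∈p⊕q a (λ b → x∉p (subst (_∈ p) (x∈⁅y⁆⇒x≡y x b) a))
  ... | inj₂ b = x∉p∧x∈q⇒x∈p⊕q (λ a → x∉p (subst (_∈ p) (x∈⁅y⁆⇒x≡y x b) a)) b
  ⊕⊆∪ : p ⊕ ⁅ x ⁆ ⊆ p ∪ ⁅ x ⁆
  ⊕⊆∪ = ⊕-least (p⊆p∪q ⁅ x ⁆) (q⊆p∪q p ⁅ x ⁆)

[p-x]∪⁅x⁆≡p : {x : Fin n} {p : Subset n} → x ∈ p → (p - x) ∪ ⁅ x ⁆ ≡ p
[p-x]∪⁅x⁆≡p {x = x} {p} x∈p = ⊆-antisym ⊆p p⊆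
  where
  ⊆p : (p - x) ∪ ⁅ x ⁆ ⊆ p
  ⊆p = ∪-least (p-x⊆p p) (x∈p⇒⁅x⁆⊆p x∈p)
  p⊆ : p ⊆ (p - x) ∪ ⁅ x ⁆
  p⊆ {y} i with y ≟ᶠ x
  ... | yes refl = q⊆p∪q (p - x) ⁅ x ⁆ (x∈⁅x⁆ x)
  ... | no  y≢x  = p⊆p∪q ⁅ x ⁆ (x∈p∧x≢y⇒x∈p-y i y≢x)

x∈p∪⁅y⁆∧x≢y⇒x∈p : {x y : Fin n} {p : Subset n} → x ∈ p ∪ ⁅ y ⁆ → x ≢ y → x ∈ p
x∈p∪⁅y⁆∧x≢y⇒x∈p {y = y} {p} i x≢y with x∈p∪q⁻ p ⁅ y ⁆ i
... | inj₁ a = a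
... | inj₂ b = absurd (x≢y (x∈⁅y⁆⇒x≡y y b))

p-x⊆q⇒p⊆⁅x⁆∪q : {x : Fin n} {p q : Subset n} → p - x ⊆ q → p ⊆ ⁅ x ⁆ ∪ q
p-x⊆q⇒p⊆⁅x⁆∪q {x = x} {p} {q} p-x⊆q {y} y∈p with y ≟ᶠ x
... | yes refl = p⊆p∪q q (x∈⁅x⁆ x)
... | no  y≢x  = q⊆p∪q ⁅ x ⁆ q (p-x⊆q (x∈p∧x≢y⇒x∈p-y y∈p y≢x))

p-x≡⊥⇒p⊆⁅x⁆ : {x : Fin n} {p : Subset n} → p - x ≡ ⊥ → p ⊆ ⁅ x ⁆
p-x≡⊥⇒p⊆⁅x⁆ {x = x} p-x≡⊥ {y} y∈p with y ≟ᶠ x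
... | yes refl = x∈⁅x⁆ x
... | no  y≢x  = absurd (∉⊥ (subst (y ∈_) p-x≡⊥ (x∈p∧x≢y⇒x∈p-y y∈p y≢x)))

q≡p⊕[q─p] : {p q : Subset n} → p ⊆ q → q ≡ p ⊕ (q ─ p)
q≡p⊕[q─p] {p = p} {q} p⊆q = ⊆-antisym q⊆ ⊆q
  where
  q⊆ : q ⊆ p ⊕ (q ─ p)
  q⊆ {x} i with x ∈? p
  ... | yes a = x∈p∧x∉q⇒x∈p⊕q a (λ j → x∈p─q⇒x∉q j a)
  ... | no  a = x∉p∧x∈q⇒x∈p⊕q a (x∈p∧x∉q⇒x∈p─q i a)
  ⊆q : p ⊕ (q ─ p) ⊆ q
  ⊆q = ⊕-least p⊆q (p─q⊆p q p)

p─[p─q]≡q : {p q : Subset n} → q ⊆ p → p ─ (p ─ q) ≡ q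
p─[p─q]≡q {p = p} {q} q⊆p = ⊆-antisym ⊆q q⊆
  where
  ⊆q : p ─ (p ─ q) ⊆ q
  ⊆q {x} i with x ∈? q
  ... | yes x∈q = x∈q
  ... | no  x∉q = absurd (x∈p─q⇒x∉q i (x∈p∧x∉q⇒x∈p─q (p─q⊆p p (p ─ q) i) x∉q))
  q⊆ : q ⊆ p ─ (p ─ q)
  q⊆ x∈q = x∈p∧x∉q⇒x∈p─q (q⊆p x∈q) (λ j → x∈p─q⇒x∉q j x∈q)

⊆⁅x⁆⇒≡⁅x⁆ : {x : Fin n} {p : Subset n} → p ⊆ ⁅ x ⁆ → x ∈ p → p ≡ ⁅ x ⁆
⊆⁅x⁆⇒≡⁅x⁆ p⊆ x∈p = ⊆-antisym p⊆ (x∈p⇒⁅x⁆⊆p x∈p)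

p⊆q∧x∉p⇒∣p∣<∣q∣ : {x : Fin n} {p q : Subset n} → p ⊆ q → x ∈ q → x ∉ p → ∣ p ∣ < ∣ q ∣
p⊆q∧x∉p⇒∣p∣<∣q∣ p⊆q x∈q x∉p = p⊂q⇒∣p∣<∣q∣ (p⊆q , _ , x∈q , x∉p)

p⊆q∧∣q∣≤∣p∣⇒p≡q : {p q : Subset n} → p ⊆ q → ∣ q ∣ ≤ ∣ p ∣ → p ≡ q
p⊆q∧∣q∣≤∣p∣⇒p≡q {p = p} {q} p⊆q ∣q∣≤∣p∣ with ⊆⊎∃∉ p q
... | inj₁ q⊆p = ⊆-antisym p⊆q q⊆p
... | inj₂ (x , x∈q , x∉p) = absurd (n≮n _ (<-≤-trans (p⊆q∧x∉p⇒∣p∣<∣q∣ p⊆q x∈q x∉p) ∣q∣≤∣p∣))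

∣p∪⁅x⁆∣≡1+∣p∣ : (p : Subset n) (x : Fin n) → x ∉ p → ∣ p ∪ ⁅ x ⁆ ∣ ≡ suc ∣ p ∣
∣p∪⁅x⁆∣≡1+∣p∣ (true  ∷ p) zero    x∉p = absurd (x∉p here)
∣p∪⁅x⁆∣≡1+∣p∣ (false ∷ p) zero    x∉p = cong (λ s → suc ∣ s ∣) (∪-identityʳ p)
∣p∪⁅x⁆∣≡1+∣p∣ (true  ∷ p) (suc x) x∉p = cong suc (∣p∪⁅x⁆∣≡1+∣p∣ p x (λ i → x∉p (there i)))
∣p∪⁅x⁆∣≡1+∣p∣ (false ∷ p) (suc x) x∉p = ∣p∪⁅x⁆∣≡1+∣p∣ p x (λ i → x∉p (there i))

∣p∣≡1+∣p-x∣ : {x : Fin n} {p : Subset n} → x ∈ p → ∣ p ∣ ≡ suc ∣ p - x ∣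
∣p∣≡1+∣p-x∣ {x = x} {p} x∈p =
  trans (cong ∣_∣ (sym ([p-x]∪⁅x⁆≡p x∈p))) (∣p∪⁅x⁆∣≡1+∣p∣ (p - x) x (x∉p-x p))

2+∣p∣≤∣q∣ : {x y : Fin n} {p q : Subset n} → p ⊆ q → x ∈ q → y ∈ q → x ∉ p → y ∉ p → x ≢ y →
  suc (suc ∣ p ∣) ≤ ∣ q ∣
2+∣p∣≤∣q∣ {x = x} {y} {p} {q} p⊆q x∈q y∈q x∉p y∉p x≢y =
  subst (λ k → suc k ≤ ∣ q ∣) (∣p∪⁅x⁆∣≡1+∣p∣ p x x∉p)
    (p⊆q∧x∉p⇒∣p∣<∣q∣ (∪-least p⊆q (x∈p⇒⁅x⁆⊆p x∈q)) y∈q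
                     (λ i → y∉p (x∈p∪⁅y⁆∧x≢y⇒x∈p i (λ y≡x → x≢y (sym y≡x)))))

size4⇒Nonempty : {p : Subset n} → ∣ p ∣ ≡ 4 → Nonempty p
size4⇒Nonempty {n} {p} ∣p∣≡4 with ≡⊥⊎Nonempty p
... | inj₂ ne = ne
... | inj₁ p≡⊥ with trans (sym ∣p∣≡4) (trans (cong ∣_∣ p≡⊥) (∣⊥∣≡0 n))
...   | ()

subset-of-size : (p : Subset n) (k : ℕ) → k ≤ ∣ p ∣ → ∃ λ q → q ⊆ p × ∣ q ∣ ≡ k
subset-of-size {n} p zero _ = ⊥ , (λ i → absurd (∉⊥ i)) , ∣⊥∣≡0 n
subset-of-size (false ∷ p) (suc k) k<∣p∣ with subset-of-size p (suc k) k<∣p∣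
... | q , q⊆p , ∣q∣≡ = false ∷ q , s⊆s q⊆p , ∣q∣≡
subset-of-size (true ∷ p) (suc k) (s≤s k≤∣p∣) with subset-of-size p k k≤∣p∣
... | q , q⊆p , ∣q∣≡ = true ∷ q , s⊆s q⊆p , cong suc ∣q∣≡

size-induction : (P : Subset n → Set) → (∀ p → (∀ q → ∣ q ∣ < ∣ p ∣ → P q) → P p) → ∀ p → P p
size-induction P step p = go (suc ∣ p ∣) p ≤-refl
  where
  go : ∀ m p → ∣ p ∣ < m → P p
  go (suc m) p (s≤s ∣p∣≤m) = step p (λ q ∣q∣<∣p∣ → go m q (<-≤-trans ∣q∣<∣p∣ ∣p∣≤m))

colSum-⊥ : (φ : Fin n → Vec Bool r) → colSum φ ⊥ ≡ 𝟘
colSum-⊥ {zero}  φ = refl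
colSum-⊥ {suc n} φ = colSum-⊥ (λ i → φ (suc i))

colSum-⁅⁆ : (φ : Fin n → Vec Bool r) (x : Fin n) → colSum φ ⁅ x ⁆ ≡ φ x
colSum-⁅⁆ φ zero    = trans (cong (φ zero ⊕_) (colSum-⊥ (λ i → φ (suc i)))) (⊕-identityʳ (φ zero))
colSum-⁅⁆ φ (suc x) = colSum-⁅⁆ (λ i → φ (suc i)) x

colSum-⊕ : (φ : Fin n → Vec Bool r) (p q : Subset n) → colSum φ (p ⊕ q) ≡ colSum φ p ⊕ colSum φ q
colSum-⊕ φ [] [] = sym (⊕-identityʳ 𝟘)
colSum-⊕ φ (false ∷ p) (false ∷ q) = colSum-⊕ (λ i → φ (suc i)) p q
colSum-⊕ φ (true  ∷ p) (false ∷ q) =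
  trans (cong (φ zero ⊕_) (colSum-⊕ (λ i → φ (suc i)) p q)) (sym (⊕-assoc _ _ _))
colSum-⊕ φ (false ∷ p) (true  ∷ q) =
  trans (cong (φ zero ⊕_) (colSum-⊕ (λ i → φ (suc i)) p q)) (⊕-left-swap _ _ _)
colSum-⊕ φ (true  ∷ p) (true  ∷ q) =
  trans (colSum-⊕ (λ i → φ (suc i)) p q) (⊕-absorb-common (φ zero) _ _)

colSum-closed : (φ : Fin n → Vec Bool r) (P : Vec Bool r → Set) → P 𝟘 →
  (∀ {u v} → P u → P v → P (u ⊕ v)) → ∀ p → (∀ {x} → x ∈ p → P (φ x)) → P (colSum φ p)
colSum-closed φ P P𝟘 P⊕ [] _ = P𝟘
colSum-closed φ P P𝟘 P⊕ (false ∷ p) Pφ =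
  colSum-closed (λ i → φ (suc i)) P P𝟘 P⊕ p (λ i → Pφ (there i))
colSum-closed φ P P𝟘 P⊕ (true ∷ p) Pφ =
  P⊕ (Pφ here) (colSum-closed (λ i → φ (suc i)) P P𝟘 P⊕ p (λ i → Pφ (there i)))

module _ (φ : Fin n → Vec Bool r) where

  colSum-split : {p q : Subset n} → p ⊆ q → colSum φ q ≡ colSum φ p ⊕ colSum φ (q ─ p)
  colSum-split {p} {q} p⊆q = trans (cong (colSum φ) (q≡p⊕[q─p] p⊆q)) (colSum-⊕ φ p (q ─ p))

  colSum-insert : {x : Fin n} {p : Subset n} → x ∉ p → colSum φ (p ∪ ⁅ x ⁆) ≡ colSum φ p ⊕ φ x
  colSum-insert {x} {p} x∉p = begin
    colSum φ (p ∪ ⁅ x ⁆)            ≡⟨ cong (colSum φ) (p∪⁅x⁆≡p⊕⁅x⁆ x∉p) ⟩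
    colSum φ (p ⊕ ⁅ x ⁆)            ≡⟨ colSum-⊕ φ p ⁅ x ⁆ ⟩
    colSum φ p ⊕ colSum φ ⁅ x ⁆     ≡⟨ cong (colSum φ p ⊕_) (colSum-⁅⁆ φ x) ⟩
    colSum φ p ⊕ φ x                ∎
    where open ≡-Reasoning

  colSum-remove : {x : Fin n} {p : Subset n} → x ∈ p → colSum φ (p - x) ⊕ φ x ≡ colSum φ p
  colSum-remove {x} {p} x∈p =
    trans (sym (colSum-insert (x∉p-x p))) (cong (colSum φ) ([p-x]∪⁅x⁆≡p x∈p))

-- Spans and independence modulo a set, over GF(2)

module Span (φ : Fin n → Vec Bool r) where

  InSpan : Subset n → Vec Bool r → Set
  InSpan K v = ∃ λ T → T ⊆ K × colSum φ T ≡ v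

  InSpan-𝟘 : ∀ K → InSpan K 𝟘
  InSpan-𝟘 K = ⊥ , (λ i → absurd (∉⊥ i)) , colSum-⊥ φ

  InSpan-⊕ : ∀ K {u v} → InSpan K u → InSpan K v → InSpan K (u ⊕ v)
  InSpan-⊕ K (T , T⊆K , refl) (T′ , T′⊆K , refl) = T ⊕ T′ , ⊕-least T⊆K T′⊆K , colSum-⊕ φ T T′

  InSpan-≡𝟘 : ∀ K {v} → v ≡ 𝟘 → InSpan K v
  InSpan-≡𝟘 K refl = InSpan-𝟘 K

  InSpan-colSum : ∀ {K Y} → Y ⊆ K → InSpan K (colSum φ Y)
  InSpan-colSum Y⊆K = _ , Y⊆K , refl

  InSpan-φ : ∀ K {x} → x ∈ K → InSpan K (φ x)
  InSpan-φ K {x} x∈K = ⁅ x ⁆ , x∈p⇒⁅x⁆⊆p x∈K , colSum-⁅⁆ φ x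

  InSpan-mono : ∀ {K K′} → K ⊆ K′ → ∀ {v} → InSpan K v → InSpan K′ v
  InSpan-mono K⊆K′ (T , T⊆K , eq) = T , (λ i → K⊆K′ (T⊆K i)) , eq

  InSpan-all : ∀ K Y → (∀ {x} → x ∈ Y → InSpan K (φ x)) → InSpan K (colSum φ Y)
  InSpan-all K = colSum-closed φ (InSpan K) (InSpan-𝟘 K) (InSpan-⊕ K)

  InSpan-trans : ∀ {K K′} → (∀ {x} → x ∈ K → InSpan K′ (φ x)) → ∀ {v} → InSpan K v → InSpan K′ v
  InSpan-trans {K′ = K′} gen (T , T⊆K , refl) = InSpan-all K′ T (λ i → gen (T⊆K i))

  InSpan-cancel : ∀ K {u v} → InSpan K (u ⊕ v) → InSpan K u → InSpan K v
  InSpan-cancel K {u} {v} u⊕v u′ = subst (InSpan K) (⊕-involutiveˡ u v) (InSpan-⊕ K u′ u⊕v)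

  InSpan-cancelʳ : ∀ K {u v} → InSpan K (u ⊕ v) → InSpan K v → InSpan K u
  InSpan-cancelʳ K {u} {v} u⊕v v′ = InSpan-cancel K (subst (InSpan K) (⊕-comm u v) u⊕v) v′

  InSpan-⊥ : ∀ {v} → InSpan ⊥ v → v ≡ 𝟘
  InSpan-⊥ (T , T⊆⊥ , refl) = trans (cong (colSum φ) (∉-everywhere⇒≡⊥ (λ i → ∉⊥ (T⊆⊥ i)))) (colSum-⊥ φ)

  InSpan? : ∀ K v → Dec (InSpan K v)
  InSpan? K v = anySubset? (λ T → (T ⊆? K) ×-dec (colSum φ T ≟ᵛ v))

  -- independence in the contraction by K of the vector matroid of φ
  IndepModulo : Subset n → Subset n → Set
  IndepModulo K X = ∀ Y → Y ⊆ X → InSpan K (colSum φ Y) → Y ≡ ⊥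

  DepModulo : Subset n → Subset n → Set
  DepModulo K X = ∃ λ Y → Y ⊆ X × InSpan K (colSum φ Y) × Y ≢ ⊥

  IndepModulo⊎DepModulo : ∀ K X → IndepModulo K X ⊎ DepModulo K X
  IndepModulo⊎DepModulo K X
    with anySubset? (λ Y → (Y ⊆? X) ×-dec (InSpan? K (colSum φ Y) ×-dec ¬? (≡-dec _≟ᵇ_ Y ⊥)))
  ... | yes (Y , Y⊆X , sp , Y≢⊥) = inj₂ (Y , Y⊆X , sp , Y≢⊥)
  ... | no ¬dep = inj₁ indep
    where
    indep : IndepModulo K X
    indep Y Y⊆X sp with ≡-dec _≟ᵇ_ Y ⊥
    ... | yes Y≡⊥ = Y≡⊥
    ... | no  Y≢⊥ = absurd (¬dep (Y , Y⊆X , sp , Y≢⊥))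

  DepModulo⇒¬IndepModulo : ∀ {K X} → DepModulo K X → ¬ IndepModulo K X
  DepModulo⇒¬IndepModulo (Y , Y⊆X , sp , Y≢⊥) indep = Y≢⊥ (indep Y Y⊆X sp)

  IndepModulo? : ∀ K X → Dec (IndepModulo K X)
  IndepModulo? K X with IndepModulo⊎DepModulo K X
  ... | inj₁ i = yes i
  ... | inj₂ d = no (DepModulo⇒¬IndepModulo d)

  InSpan-∪ : ∀ F K {v} → InSpan (F ∪ K) v → ∃ λ Y → Y ⊆ F × InSpan K (v ⊕ colSum φ Y)
  InSpan-∪ F K (T , T⊆F∪K , refl) = T ─ K , T─K⊆F , T ─ (T ─ K) , T─[T─K]⊆K , sym Σ≡
    where
    T─K⊆F : T ─ K ⊆ F
    T─K⊆F i with x∈p∪q⁻ F K (T⊆F∪K (p─q⊆p T K i))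
    ... | inj₁ a = a
    ... | inj₂ b = absurd (x∈p─q⇒x∉q i b)
    T─[T─K]⊆K : T ─ (T ─ K) ⊆ K
    T─[T─K]⊆K {x} i with x ∈? K
    ... | yes x∈K = x∈K
    ... | no  x∉K = absurd (x∈p─q⇒x∉q i (x∈p∧x∉q⇒x∈p─q (p─q⊆p T (T ─ K) i) x∉K))
    Σ≡ : colSum φ T ⊕ colSum φ (T ─ K) ≡ colSum φ (T ─ (T ─ K))
    Σ≡ = trans (cong (_⊕ colSum φ (T ─ K)) (colSum-split φ (p─q⊆p T K))) (⊕-cancel-outer _ _)

  InSpan-─ : ∀ K C {Y} → InSpan K (colSum φ Y) → InSpan (K ∪ C) (colSum φ (Y ─ C))
  InSpan-─ K C {Y} sp = subst (InSpan (K ∪ C)) Σ≡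
    (InSpan-⊕ (K ∪ C) (InSpan-mono (p⊆p∪q C) sp) (InSpan-colSum Y─[Y─C]⊆K∪C))
    where
    Y─[Y─C]⊆K∪C : Y ─ (Y ─ C) ⊆ K ∪ C
    Y─[Y─C]⊆K∪C {x} i with x ∈? C
    ... | yes x∈C = q⊆p∪q K C x∈C
    ... | no  x∉C = absurd (x∈p─q⇒x∉q i (x∈p∧x∉q⇒x∈p─q (p─q⊆p Y (Y ─ C) i) x∉C))
    Σ≡ : colSum φ Y ⊕ colSum φ (Y ─ (Y ─ C)) ≡ colSum φ (Y ─ C)
    Σ≡ = trans (cong (_⊕ colSum φ (Y ─ (Y ─ C))) (colSum-split φ (p─q⊆p Y C))) (⊕-involutiveʳ _ _)

  DepModulo-⁅⁆ : ∀ {K x} → DepModulo K ⁅ x ⁆ → InSpan K (φ x)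
  DepModulo-⁅⁆ {K} {x} (Y , Y⊆x , sp , Y≢⊥) with ≡⊥⊎Nonempty Y
  ... | inj₁ Y≡⊥ = absurd (Y≢⊥ Y≡⊥)
  ... | inj₂ (y , y∈Y) = subst (InSpan K) Σ≡ sp
    where
    Σ≡ : colSum φ Y ≡ φ x
    Σ≡ = trans (cong (colSum φ) (⊆⁅x⁆⇒≡⁅x⁆ Y⊆x (subst (_∈ Y) (x∈⁅y⁆⇒x≡y x (Y⊆x y∈Y)) y∈Y))) (colSum-⁅⁆ φ x)

  IndepModulo-⁅⁆ : ∀ {K x} → IndepModulo K ⁅ x ⁆ → ¬ InSpan K (φ x)
  IndepModulo-⁅⁆ {K} {x} indep sp =
    ∉⊥ (subst (x ∈_) (indep ⁅ x ⁆ (λ i → i) (subst (InSpan K) (sym (colSum-⁅⁆ φ x)) sp)) (x∈⁅x⁆ x))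

  DepModulo-pair : ∀ {K x y} → x ≢ y → DepModulo K (⁅ x ⁆ ∪ ⁅ y ⁆) →
    InSpan K (φ x) ⊎ InSpan K (φ y) ⊎ InSpan K (φ x ⊕ φ y)
  DepModulo-pair {K} {x} {y} x≢y (Y , Y⊆xy , sp , Y≢⊥) with x ∈? Y | y ∈? Y
  ... | yes x∈Y | yes y∈Y = inj₂ (inj₂ (subst (InSpan K) Σ≡ sp))
    where
    Σ≡ : colSum φ Y ≡ φ x ⊕ φ y
    Σ≡ = begin
      colSum φ Y                  ≡⟨ cong (colSum φ) (⊆-antisym Y⊆xy (∪-least (x∈p⇒⁅x⁆⊆p x∈Y) (x∈p⇒⁅x⁆⊆p y∈Y))) ⟩
      colSum φ (⁅ x ⁆ ∪ ⁅ y ⁆)    ≡⟨ colSum-insert φ (λ i → x≢y (sym (x∈⁅y⁆⇒x≡y x i))) ⟩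
      colSum φ ⁅ x ⁆ ⊕ φ y        ≡⟨ cong (_⊕ φ y) (colSum-⁅⁆ φ x) ⟩
      φ x ⊕ φ y                   ∎
      where open ≡-Reasoning
  ... | yes x∈Y | no y∉Y =
    inj₁ (DepModulo-⁅⁆ (Y , (λ i → x∈p∪⁅y⁆∧x≢y⇒x∈p (Y⊆xy i) (λ { refl → y∉Y i })) , sp , Y≢⊥))
  ... | no x∉Y | yes y∈Y = inj₂ (inj₁ (DepModulo-⁅⁆ (Y , Y⊆y , sp , Y≢⊥)))
    where
    Y⊆y : Y ⊆ ⁅ y ⁆
    Y⊆y {z} i with x∈p∪q⁻ ⁅ x ⁆ ⁅ y ⁆ (Y⊆xy i)
    ... | inj₁ a = absurd (x∉Y (subst (_∈ Y) (x∈⁅y⁆⇒x≡y x a) i))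
    ... | inj₂ b = b
  ... | no x∉Y | no y∉Y = absurd (Y≢⊥ (∉-everywhere⇒≡⊥ none))
    where
    none : ∀ {z} → z ∉ Y
    none {z} i with x∈p∪q⁻ ⁅ x ⁆ ⁅ y ⁆ (Y⊆xy i)
    ... | inj₁ a = x∉Y (subst (_∈ Y) (x∈⁅y⁆⇒x≡y x a) i)
    ... | inj₂ b = y∉Y (subst (_∈ Y) (x∈⁅y⁆⇒x≡y y b) i)

  RepresentsModulo : Subset n → MData n → Set
  RepresentsModulo K N =
    ∀ X → X ⊆ E N → (Indep N X → IndepModulo K X) × (IndepModulo K X → Indep N X)

  RepresentsModulo-restrict : ∀ {K N F} → RepresentsModulo K N → F ⊆ E N →
    RepresentsModulo K (restrict N F)
  RepresentsModulo-restrict rep F⊆E X X⊆F =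
    (λ (_ , i) → proj₁ (rep X (λ j → F⊆E (X⊆F j))) i) ,
    (λ i → X⊆F , proj₂ (rep X (λ j → F⊆E (X⊆F j))) i)

  MinimalDep : Subset n → Subset n → Set
  MinimalDep K Z = Nonempty Z × InSpan K (colSum φ Z) ×
    (∀ Y → Y ⊆ Z → InSpan K (colSum φ Y) → Y ≡ ⊥ ⊎ Y ≡ Z)

  smallest⇒MinimalDep : ∀ {K g Y} → g ∉ Y → InSpan K (φ g ⊕ colSum φ Y) →
    (∀ Y′ → ∣ Y′ ∣ < ∣ Y ∣ → Y′ ⊆ Y → ¬ InSpan K (φ g ⊕ colSum φ Y′)) → MinimalDep K (Y ∪ ⁅ g ⁆)
  smallest⇒MinimalDep {K} {g} {Y} g∉Y sp smaller =
    (g , q⊆p∪q Y ⁅ g ⁆ (x∈⁅x⁆ g)) ,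
    subst (InSpan K) (trans (⊕-comm _ _) (sym (colSum-insert φ g∉Y))) sp ,
    minimal
    where
    minimal : ∀ W → W ⊆ Y ∪ ⁅ g ⁆ → InSpan K (colSum φ W) → W ≡ ⊥ ⊎ W ≡ Y ∪ ⁅ g ⁆
    minimal W W⊆Y+g spW with g ∈? W
    ... | no g∉W with ≡⊥⊎Nonempty W
    ...   | inj₁ W≡⊥ = inj₁ W≡⊥
    ...   | inj₂ (w , w∈W) = absurd (smaller (Y ⊕ W) ∣Y⊕W∣<∣Y∣ Y⊕W⊆Y spY⊕W)
      where
      W⊆Y : W ⊆ Y
      W⊆Y i = x∈p∪⁅y⁆∧x≢y⇒x∈p (W⊆Y+g i) (λ { refl → g∉W i })
      Y⊕W⊆Y : Y ⊕ W ⊆ Y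
      Y⊕W⊆Y = ⊕-least (λ i → i) W⊆Y
      ∣Y⊕W∣<∣Y∣ : ∣ Y ⊕ W ∣ < ∣ Y ∣
      ∣Y⊕W∣<∣Y∣ = p⊆q∧x∉p⇒∣p∣<∣q∣ Y⊕W⊆Y (W⊆Y w∈W) (x∈p∩q⇒x∉p⊕q (W⊆Y w∈W) w∈W)
      spY⊕W : InSpan K (φ g ⊕ colSum φ (Y ⊕ W))
      spY⊕W = subst (InSpan K) (trans (⊕-assoc _ _ _) (cong (φ g ⊕_) (sym (colSum-⊕ φ Y W))))
                (InSpan-⊕ K sp spW)
    minimal W W⊆Y+g spW | yes g∈W with ⊆⊎∃∉ (W - g) Y
    ... | inj₁ Y⊆W-g = inj₂ (⊆-antisym W⊆Y+g (∪-least (λ i → p-x⊆p W (Y⊆W-g i)) (x∈p⇒⁅x⁆⊆p g∈W)))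
    ... | inj₂ (x , x∈Y , x∉W-g) = absurd (smaller (W - g) (p⊆q∧x∉p⇒∣p∣<∣q∣ W-g⊆Y x∈Y x∉W-g) W-g⊆Y spW-g)
      where
      W-g⊆Y : W - g ⊆ Y
      W-g⊆Y i = x∈p∪⁅y⁆∧x≢y⇒x∈p (W⊆Y+g (p-x⊆p W i)) (x∈p-y⇒x≢y i)
      spW-g : InSpan K (φ g ⊕ colSum φ (W - g))
      spW-g = subst (InSpan K) (sym (trans (⊕-comm _ _) (colSum-remove φ g∈W))) spW

  module Circuits {K : Subset n} {N : MData n} (rep : RepresentsModulo K N) where

    InSpan⇒¬Indep : ∀ {Z x} → Z ⊆ E N → InSpan K (colSum φ Z) → x ∈ Z → ¬ Indep N Z
    InSpan⇒¬Indep {Z} {x} Z⊆E sp x∈Z i = ∉⊥ (subst (x ∈_) (proj₁ (rep Z Z⊆E) i Z (λ j → j) sp) x∈Z)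

    circuit⇒MinimalDep : ∀ {C} → IsCircuit N C → MinimalDep K C
    circuit⇒MinimalDep {C} (C⊆E , dep , C-x-indep) = nonempty , dependent , minimal
      where
      minimal : ∀ Y → Y ⊆ C → InSpan K (colSum φ Y) → Y ≡ ⊥ ⊎ Y ≡ C
      minimal Y Y⊆C sp with ⊆⊎∃∉ Y C
      ... | inj₁ C⊆Y = inj₂ (⊆-antisym Y⊆C C⊆Y)
      ... | inj₂ (x , x∈C , x∉Y) = inj₁
        (proj₁ (rep (C - x) (λ j → C⊆E (p-x⊆p C j))) (C-x-indep x x∈C) Y Y⊆C-x sp)
        where
        Y⊆C-x : Y ⊆ C - x
        Y⊆C-x j = x∈p∧x≢y⇒x∈p-y (Y⊆C j) (λ { refl → x∉Y j })
      dependent : InSpan K (colSum φ C)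
      dependent with IndepModulo⊎DepModulo K C
      ... | inj₁ i = absurd (dep (proj₂ (rep C C⊆E) i))
      ... | inj₂ (Y , Y⊆C , sp , Y≢⊥) with minimal Y Y⊆C sp
      ...   | inj₁ Y≡⊥ = absurd (Y≢⊥ Y≡⊥)
      ...   | inj₂ Y≡C = subst (λ W → InSpan K (colSum φ W)) Y≡C sp
      nonempty : Nonempty C
      nonempty with ≡⊥⊎Nonempty C
      ... | inj₂ ne = ne
      ... | inj₁ C≡⊥ = absurd (dep (proj₂ (rep C C⊆E) λ Y Y⊆C _ →
                                    ∉-everywhere⇒≡⊥ (λ i → ∉⊥ (subst (_ ∈_) C≡⊥ (Y⊆C i)))))

    MinimalDep⇒circuit : ∀ {Z} → Z ⊆ E N → MinimalDep K Z → IsCircuit N Z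
    MinimalDep⇒circuit {Z} Z⊆E ((z , z∈Z) , dependent , minimal) =
      Z⊆E , InSpan⇒¬Indep Z⊆E dependent z∈Z , Z-x-indep
      where
      Z-x-indep : ∀ x → x ∈ Z → Indep N (Z - x)
      Z-x-indep x x∈Z = proj₂ (rep (Z - x) (λ j → Z⊆E (p-x⊆p Z j))) indep
        where
        indep : IndepModulo K (Z - x)
        indep Y Y⊆Z-x sp with minimal Y (λ j → p-x⊆p Z (Y⊆Z-x j)) sp
        ... | inj₁ Y≡⊥ = Y≡⊥
        ... | inj₂ Y≡Z = absurd (x∉p-x Z (Y⊆Z-x (subst (x ∈_) (sym Y≡Z) x∈Z)))

proper⊆circuit⇒Indep : {M : MData n} → IsMatroid M → ∀ {C Y x} → IsCircuit M C →
  Y ⊆ C → x ∈ C → x ∉ Y → Indep M Y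
proper⊆circuit⇒Indep isM {C} {Y} {x} (_ , _ , C-x-indep) Y⊆C x∈C x∉Y =
  IsMatroid.I2 isM (C - x) Y (λ j → x∈p∧x≢y⇒x∈p-y (Y⊆C j) (λ { refl → x∉Y j })) (C-x-indep x x∈C)

-- Contracting all but four elements of a circuit leaves a four-element circuit, i.e. U₃,₄.
module FourCircuitMinor {M : MData n} (isM : IsMatroid M) {C : Subset n} (circ : IsCircuit M C)
                        (K : Subset n) (K⊆C : K ⊆ C) (∣C─K∣≡4 : ∣ C ─ K ∣ ≡ 4) where

  open IsMatroid isM

  R = restrict M C
  S = C ─ K
  N = contract R K

  proper⊆C⇒Indep : ∀ {X s} → X ⊆ C → s ∈ C → s ∉ X → Indep R X
  proper⊆C⇒Indep X⊆C s∈C s∉X = X⊆C , proper⊆circuit⇒Indep isM circ X⊆C s∈C s∉X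

  s₀ : Fin n
  s₀ = proj₁ (size4⇒Nonempty {p = S} ∣C─K∣≡4)

  s₀∈S : s₀ ∈ S
  s₀∈S = proj₂ (size4⇒Nonempty {p = S} ∣C─K∣≡4)

  K-basis : IsBasisOf R K K
  K-basis = (λ j → j) , proper⊆C⇒Indep K⊆C (p─q⊆p C K s₀∈S) (x∈p─q⇒x∉q s₀∈S) ,
            λ _ e∈K e∉K → absurd (e∉K e∈K)

  basis⊇K : ∀ {B} → IsBasisOf R K B → K ⊆ B
  basis⊇K {B} (B⊆K , _ , maximal) {e} e∈K with e ∈? B
  ... | yes e∈B = e∈B
  ... | no  e∉B = absurd (maximal e e∈K e∉B (proper⊆C⇒Indep (λ j → K⊆C (B+e⊆K j)) (p─q⊆p C K s₀∈S) s₀∉B+e))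
    where
    B+e⊆K : B ∪ ⁅ e ⁆ ⊆ K
    B+e⊆K = ∪-least B⊆K (x∈p⇒⁅x⁆⊆p e∈K)
    s₀∉B+e : s₀ ∉ B ∪ ⁅ e ⁆
    s₀∉B+e i = x∈p─q⇒x∉q s₀∈S (B+e⊆K i)

  proper⊆S⇒Indep : ∀ {X s} → X ⊆ S → s ∈ S → s ∉ X → Indep N X
  proper⊆S⇒Indep {X} {s} X⊆S s∈S s∉X = X⊆S , K , K-basis , proper⊆C⇒Indep X∪K⊆C (p─q⊆p C K s∈S) s∉X∪K
    where
    X∪K⊆C : X ∪ K ⊆ C
    X∪K⊆C = ∪-least (λ i → p─q⊆p C K (X⊆S i)) K⊆C
    s∉X∪K : s ∉ X ∪ K
    s∉X∪K i with x∈p∪q⁻ X K i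
    ... | inj₁ a = s∉X a
    ... | inj₂ b = x∈p─q⇒x∉q s∈S b

  S-dependent : ∀ {X} → Indep N X → ¬ (S ⊆ X)
  S-dependent {X} (_ , B , B-basis , (_ , X∪B-indep)) S⊆X = proj₁ (proj₂ circ) (I2 (X ∪ B) C C⊆X∪B X∪B-indep)
    where
    C⊆X∪B : C ⊆ X ∪ B
    C⊆X∪B {x} x∈C with x ∈? K
    ... | yes x∈K = q⊆p∪q X B (basis⊇K B-basis x∈K)
    ... | no  x∉K = p⊆p∪q B (S⊆X (x∈p∧x∉q⇒x∈p─q x∈C x∉K))

  small⇒Indep : ∀ {X} → X ⊆ S → ∣ X ∣ ≤ 3 → Indep N X
  small⇒Indep {X} X⊆S ∣X∣≤3 with ⊆⊎∃∉ X S
  ... | inj₂ (s , s∈S , s∉X) = proper⊆S⇒Indep X⊆S s∈S s∉X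
  ... | inj₁ S⊆X = absurd (n≮n 3 (subst (_≤ 3) (trans (cong ∣_∣ (⊆-antisym X⊆S S⊆X)) ∣C─K∣≡4) ∣X∣≤3))

  Indep⇒small : ∀ {X} → X ⊆ S → Indep N X → ∣ X ∣ ≤ 3
  Indep⇒small {X} X⊆S X-indep with ∣ X ∣ ≤? 3
  ... | yes ∣X∣≤3 = ∣X∣≤3
  ... | no  ∣X∣≰3 = absurd (S-dependent X-indep (subst (S ⊆_) (sym X≡S) (λ j → j)))
    where
    X≡S : X ≡ S
    X≡S = p⊆q∧∣q∣≤∣p∣⇒p≡q X⊆S (subst (_≤ ∣ X ∣) (sym ∣C─K∣≡4) (≰⇒> ∣X∣≰3))

  U34 : IsU34 (restrict N S)
  U34 = ∣C─K∣≡4 , λ X X⊆S →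
    (λ (_ , X-indep) → Indep⇒small X⊆S X-indep) , (λ ∣X∣≤3 → X⊆S , small⇒Indep X⊆S ∣X∣≤3)

  S-simplification : IsSimplificationSet N S
  S-simplification = (λ j → j) , no-loop , no-parallel , (λ _ e∈S _ → inj₁ e∈S)
    where
    no-loop : ∀ e → e ∈ S → ¬ IsLoop N e
    no-loop e e∈S (_ , dep) = dep (small⇒Indep (x∈p⇒⁅x⁆⊆p e∈S) (subst (_≤ 3) (sym (∣⁅x⁆∣≡1 e)) (s≤s z≤n)))
    no-parallel : ∀ e f → e ∈ S → f ∈ S → ¬ Parallel N e f
    no-parallel e f e∈S f∈S (e≢f , _ , _ , _ , _ , dep) = dep (small⇒Indep ef⊆S ∣ef∣≤3)
      where
      ef⊆S : ⁅ e ⁆ ∪ ⁅ f ⁆ ⊆ S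
      ef⊆S = ∪-least (x∈p⇒⁅x⁆⊆p e∈S) (x∈p⇒⁅x⁆⊆p f∈S)
      ∣ef∣≤3 : ∣ ⁅ e ⁆ ∪ ⁅ f ⁆ ∣ ≤ 3
      ∣ef∣≤3 = subst (_≤ 3) (sym (trans (∣p∪⁅x⁆∣≡1+∣p∣ ⁅ e ⁆ f (λ i → e≢f (sym (x∈⁅y⁆⇒x≡y e i))))
                                         (cong suc (∣⁅x⁆∣≡1 e))))
                     (s≤s (s≤s z≤n))

  induced-minor : IsFlat M C → InducedMinor M (restrict N S)
  induced-minor C-flat = imContract (imRestrict imRefl C C-flat) K K⊆C S S-simplification

Represents : (M : MData n) → (Fin n → Vec Bool r) → Set
Represents M φ =
  ∀ X → X ⊆ E M → (Indep M X → GF2Independent φ X) × (GF2Independent φ X → Indep M X)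

module SimpleBinary {M : MData n} (isM : IsMatroid M) {φ : Fin n → Vec Bool r}
                    (rep : Represents M φ) (simple : IsSimple M) where

  open Span φ public
  open IsMatroid isM

  represents⊥ : RepresentsModulo ⊥ M
  represents⊥ X X⊆E =
    (λ i Y Y⊆X sp → proj₁ (rep X X⊆E) i Y Y⊆X (InSpan-⊥ sp)) ,
    (λ i → proj₂ (rep X X⊆E) (λ Y Y⊆X eq → i Y Y⊆X (InSpan-≡𝟘 ⊥ eq)))

  private module M-Circuits = Circuits represents⊥

  φ≢𝟘 : ∀ {x} → x ∈ E M → φ x ≢ 𝟘
  φ≢𝟘 {x} x∈E eq = proj₁ simple x (x∈E ,
    M-Circuits.InSpan⇒¬Indep (x∈p⇒⁅x⁆⊆p x∈E) (InSpan-≡𝟘 ⊥ (trans (colSum-⁅⁆ φ x) eq)) (x∈⁅x⁆ x))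

  circuit-colSum : ∀ {C} → IsCircuit M C → colSum φ C ≡ 𝟘
  circuit-colSum circ = InSpan-⊥ (proj₁ (proj₂ (M-Circuits.circuit⇒MinimalDep circ)))

  circuit-minimal : ∀ {C Y} → IsCircuit M C → Y ⊆ C → colSum φ Y ≡ 𝟘 → Y ≡ ⊥ ⊎ Y ≡ C
  circuit-minimal circ Y⊆C eq = proj₂ (proj₂ (M-Circuits.circuit⇒MinimalDep circ)) _ Y⊆C (InSpan-≡𝟘 ⊥ eq)

  minimal-zeroSum⇒circuit : ∀ {Z x} → Z ⊆ E M → x ∈ Z → colSum φ Z ≡ 𝟘 →
    (∀ Y → Y ⊆ Z → colSum φ Y ≡ 𝟘 → Y ≡ ⊥ ⊎ Y ≡ Z) → IsCircuit M Z
  minimal-zeroSum⇒circuit Z⊆E x∈Z eq minimal = M-Circuits.MinimalDep⇒circuit Z⊆E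
    ((_ , x∈Z) , InSpan-≡𝟘 ⊥ eq , λ Y Y⊆Z sp → minimal Y Y⊆Z (InSpan-⊥ sp))

  circuit-colSum-─ : ∀ {C Y} → IsCircuit M C → Y ⊆ C → colSum φ (C ─ Y) ≡ colSum φ Y
  circuit-colSum-─ {C} {Y} circ Y⊆C =
    sym (⊕≡𝟘⇒≡ _ _ (trans (sym (colSum-split φ Y⊆C)) (circuit-colSum circ)))

  chord-circuit : ∀ {C Y f c} → IsCircuit M C → f ∈ E M → f ∉ C → Y ⊆ C → colSum φ Y ≡ φ f →
    c ∈ C → c ∉ Y → IsCircuit M (Y ∪ ⁅ f ⁆)
  chord-circuit {C} {Y} {f} {c} circ f∈E f∉C Y⊆C ΣY≡φf c∈C c∉Y =
    minimal-zeroSum⇒circuit Z⊆E (q⊆p∪q Y ⁅ f ⁆ (x∈⁅x⁆ f)) ΣZ≡𝟘 minimal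
    where
    Z = Y ∪ ⁅ f ⁆
    Z⊆E : Z ⊆ E M
    Z⊆E = ∪-least (λ i → proj₁ circ (Y⊆C i)) (x∈p⇒⁅x⁆⊆p f∈E)
    ΣZ≡𝟘 : colSum φ Z ≡ 𝟘
    ΣZ≡𝟘 = trans (colSum-insert φ (λ j → f∉C (Y⊆C j))) (trans (cong (_⊕ φ f) ΣY≡φf) (⊕-self (φ f)))
    minimal : ∀ W → W ⊆ Z → colSum φ W ≡ 𝟘 → W ≡ ⊥ ⊎ W ≡ Z
    minimal W W⊆Z ΣW≡𝟘 with f ∈? W
    ... | no f∉W with circuit-minimal circ (λ j → Y⊆C (W⊆Y j)) ΣW≡𝟘
      where
      W⊆Y : W ⊆ Y
      W⊆Y j = x∈p∪⁅y⁆∧x≢y⇒x∈p (W⊆Z j) (λ { refl → f∉W j })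
    ...   | inj₁ W≡⊥ = inj₁ W≡⊥
    ...   | inj₂ W≡C = absurd (c∉Y (x∈p∪⁅y⁆∧x≢y⇒x∈p (W⊆Z (subst (c ∈_) (sym W≡C) c∈C))
                                                     (λ { refl → f∉C c∈C })))
    -- (W - f) ⊕ (C ─ Y) has zero sum and contains c, so it is all of C; hence Y ⊆ W
    minimal W W⊆Z ΣW≡𝟘 | yes f∈W = inj₂ (⊆-antisym W⊆Z (∪-least Y⊆W (x∈p⇒⁅x⁆⊆p f∈W)))
      where
      V = (W - f) ⊕ (C ─ Y)
      ΣV≡𝟘 : colSum φ V ≡ 𝟘
      ΣV≡𝟘 = begin
        colSum φ ((W - f) ⊕ (C ─ Y))         ≡⟨ colSum-⊕ φ (W - f) (C ─ Y) ⟩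
        colSum φ (W - f) ⊕ colSum φ (C ─ Y)  ≡⟨ cong (colSum φ (W - f) ⊕_) (circuit-colSum-─ circ Y⊆C) ⟩
        colSum φ (W - f) ⊕ colSum φ Y        ≡⟨ cong (colSum φ (W - f) ⊕_) ΣY≡φf ⟩
        colSum φ (W - f) ⊕ φ f               ≡⟨ colSum-remove φ f∈W ⟩
        colSum φ W                           ≡⟨ ΣW≡𝟘 ⟩
        𝟘                                    ∎
        where open ≡-Reasoning
      W-f⊆Y : W - f ⊆ Y
      W-f⊆Y j = x∈p∪⁅y⁆∧x≢y⇒x∈p (W⊆Z (p-x⊆p W j)) (x∈p-y⇒x≢y j)
      V⊆C : V ⊆ C
      V⊆C = ⊕-least (λ i → Y⊆C (W-f⊆Y i)) (p─q⊆p C Y)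
      c∈V : c ∈ V
      c∈V = x∉p∧x∈q⇒x∈p⊕q (λ j → c∉Y (W-f⊆Y j)) (x∈p∧x∉q⇒x∈p─q c∈C c∉Y)
      V≡C : V ≡ C
      V≡C with circuit-minimal circ V⊆C ΣV≡𝟘
      ... | inj₁ V≡⊥ = absurd (∉⊥ (subst (c ∈_) V≡⊥ c∈V))
      ... | inj₂ V≡C = V≡C
      Y⊆W : Y ⊆ W
      Y⊆W {x} x∈Y with x∈p⊕q⁻ (W - f) (C ─ Y) (subst (x ∈_) (sym V≡C) (Y⊆C x∈Y))
      ... | inj₁ (a , _) = p-x⊆p W a
      ... | inj₂ (_ , b) = absurd (x∈p─q⇒x∉q b x∈Y)

  SplitCircuit : Subset n → Set
  SplitCircuit C = ∃ λ C₁ → ∃ λ C₂ → ∃ λ e → IsCircuit M C₁ × IsCircuit M C₂ ×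
    (C₁ ∩ C₂) ≡ ⁅ e ⁆ × C ≡ ((C₁ ∪ C₂) - e)

  chord⇒SplitCircuit : ∀ {C Y f} → IsCircuit M C → f ∈ E M → f ∉ C → Y ⊆ C → colSum φ Y ≡ φ f →
    SplitCircuit C
  chord⇒SplitCircuit {C} {Y} {f} circ f∈E f∉C Y⊆C ΣY≡φf with ≡⊥⊎Nonempty Y | ⊆⊎∃∉ Y C
  ... | inj₁ Y≡⊥ | _ =
    absurd (φ≢𝟘 f∈E (trans (sym ΣY≡φf) (trans (cong (colSum φ) Y≡⊥) (colSum-⊥ φ))))
  ... | _ | inj₁ C⊆Y =
    absurd (φ≢𝟘 f∈E (trans (sym ΣY≡φf) (trans (cong (colSum φ) (⊆-antisym Y⊆C C⊆Y)) (circuit-colSum circ))))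
  ... | inj₂ (y , y∈Y) | inj₂ (c , c∈C , c∉Y) =
    C₁ , C₂ , f ,
    chord-circuit circ f∈E f∉C Y⊆C ΣY≡φf c∈C c∉Y ,
    chord-circuit circ f∈E f∉C (p─q⊆p C Y) (trans (circuit-colSum-─ circ Y⊆C) ΣY≡φf)
      (Y⊆C y∈Y) (λ j → x∈p─q⇒x∉q j y∈Y) ,
    ⊆-antisym C₁∩C₂⊆ (λ i → x∈p∩q⁺ (q⊆p∪q Y ⁅ f ⁆ i , q⊆p∪q (C ─ Y) ⁅ f ⁆ i)) ,
    ⊆-antisym C⊆ ⊆C
    where
    C₁ = Y ∪ ⁅ f ⁆
    C₂ = (C ─ Y) ∪ ⁅ f ⁆
    C₁∩C₂⊆ : C₁ ∩ C₂ ⊆ ⁅ f ⁆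
    C₁∩C₂⊆ i with x∈p∩q⁻ C₁ C₂ i
    ... | a , b with x∈p∪q⁻ Y ⁅ f ⁆ a | x∈p∪q⁻ (C ─ Y) ⁅ f ⁆ b
    ...   | inj₂ x∈⁅f⁆ | _          = x∈⁅f⁆
    ...   | inj₁ _     | inj₂ x∈⁅f⁆ = x∈⁅f⁆
    ...   | inj₁ x∈Y   | inj₁ x∈C─Y = absurd (x∈p─q⇒x∉q x∈C─Y x∈Y)
    C⊆ : C ⊆ (C₁ ∪ C₂) - f
    C⊆ {x} x∈C with x ∈? Y
    ... | yes x∈Y = x∈p∧x≢y⇒x∈p-y (p⊆p∪q C₂ (p⊆p∪q ⁅ f ⁆ x∈Y)) (λ { refl → f∉C x∈C })
    ... | no  x∉Y = x∈p∧x≢y⇒x∈p-y (q⊆p∪q C₁ C₂ (p⊆p∪q ⁅ f ⁆ (x∈p∧x∉q⇒x∈p─q x∈C x∉Y)))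
                                   (λ { refl → f∉C x∈C })
    ⊆C : (C₁ ∪ C₂) - f ⊆ C
    ⊆C i with x∈p∪q⁻ C₁ C₂ (p-x⊆p (C₁ ∪ C₂) i)
    ... | inj₁ a = Y⊆C (x∈p∪⁅y⁆∧x≢y⇒x∈p a (x∈p-y⇒x≢y i))
    ... | inj₂ b = p─q⊆p C Y (x∈p∪⁅y⁆∧x≢y⇒x∈p b (x∈p-y⇒x≢y i))

  circuit-two-others : ∀ {D e} → IsCircuit M D → e ∈ D →
    ∃ λ y → ∃ λ y′ → y ∈ D × y′ ∈ D × y ≢ e × y′ ≢ e × y ≢ y′
  circuit-two-others {D} {e} (D⊆E , dep , _) e∈D with ≡⊥⊎Nonempty (D - e)
  ... | inj₁ D-e≡⊥ =
    absurd (proj₁ simple e (D⊆E e∈D , λ i → dep (I2 ⁅ e ⁆ D (p-x≡⊥⇒p⊆⁅x⁆ D-e≡⊥) i)))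
  ... | inj₂ (y , y∈D-e) with ≡⊥⊎Nonempty (D - e - y)
  ...   | inj₂ (y′ , y′∈D-e-y) =
    y , y′ , p-x⊆p D y∈D-e , p-x⊆p D (p-x⊆p (D - e) y′∈D-e-y) ,
    x∈p-y⇒x≢y y∈D-e , x∈p-y⇒x≢y (p-x⊆p (D - e) y′∈D-e-y) , λ y≡y′ → x∈p-y⇒x≢y y′∈D-e-y (sym y≡y′)
  ...   | inj₁ D-e-y≡⊥ =
    absurd (proj₂ simple e y (e≢y , proj₁ simple e , proj₁ simple y , D⊆E e∈D , D⊆E (p-x⊆p D y∈D-e) ,
      λ i → dep (I2 (⁅ e ⁆ ∪ ⁅ y ⁆) D (p-x⊆q⇒p⊆⁅x⁆∪q (p-x≡⊥⇒p⊆⁅x⁆ D-e-y≡⊥)) i)))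
    where
    e≢y : e ≢ y
    e≢y e≡y = x∈p-y⇒x≢y y∈D-e (sym e≡y)

  HasChord : Subset n → Set
  HasChord C = ∃ λ f → f ∈ E M × f ∉ C × ∃ λ Y → Y ⊆ C × colSum φ Y ≡ φ f

  HasChord? : ∀ C → Dec (HasChord C)
  HasChord? C = any? λ f → (f ∈? E M) ×-dec ¬? (f ∈? C) ×-dec
                           anySubset? (λ Y → (Y ⊆? C) ×-dec (colSum φ Y ≟ᵛ φ f))

  chordless⇒flat : ∀ {C} → IsCircuit M C → ¬ HasChord C → IsFlat M C
  chordless⇒flat {C} (C⊆E , _) no-chord = C⊆E , no-single-outside
    where
    no-single-outside : ∀ D e → IsCircuit M D → e ∈ E M → e ∉ C → e ∈ D → ¬ (D ⊆ (C ∪ ⁅ e ⁆))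
    no-single-outside D e D-circ e∈E e∉C e∈D D⊆C+e =
      no-chord (e , e∈E , e∉C , D - e , D-e⊆C ,
                ⊕≡𝟘⇒≡ _ _ (trans (colSum-remove φ e∈D) (circuit-colSum D-circ)))
      where
      D-e⊆C : D - e ⊆ C
      D-e⊆C i = x∈p∪⁅y⁆∧x≢y⇒x∈p (D⊆C+e (p-x⊆p D i)) (x∈p-y⇒x≢y i)

  no-induced-U34⇒chordal : (¬ ∃ λ N → InducedMinor M N × IsU34 N) → IsChordal M
  no-induced-U34⇒chordal no-U34 C circ 4≤∣C∣ with HasChord? C
  ... | yes (f , f∈E , f∉C , Y , Y⊆C , ΣY≡φf) = chord⇒SplitCircuit circ f∈E f∉C Y⊆C ΣY≡φf
  ... | no  no-chord with subset-of-size C 4 4≤∣C∣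
  ...   | S , S⊆C , ∣S∣≡4 = absurd (no-U34 (_ , induced-minor (chordless⇒flat circ no-chord) , U34))
    where open FourCircuitMinor isM circ (C ─ S) (p─q⊆p C S) (trans (cong ∣_∣ (p─[p─q]≡q S⊆C)) ∣S∣≡4)

  -- Induced minors

  -- A is closed in M / K, up to loops and elements parallel to A
  ClosedModulo : Subset n → Subset n → Set
  ClosedModulo K A = ∀ e → e ∈ E M → InSpan (A ∪ K) (φ e) →
    InSpan K (φ e) ⊎ ∃ λ g → g ∈ A × InSpan K (φ e ⊕ φ g)

  -- N is the restriction of M / K to a set closed in M / K up to loops and parallel elements
  record Presentation (N : MData n) : Set where
    field
      K          : Subset n
      K⊆E        : K ⊆ E M
      E⊆E        : E N ⊆ E M
      represents : RepresentsModulo K N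
      closed     : ClosedModulo K (E N)

  presentation-refl : Presentation M
  presentation-refl = record
    { K = ⊥ ; K⊆E = λ i → absurd (∉⊥ i) ; E⊆E = λ i → i ; represents = represents⊥
    ; closed = λ e e∈E _ → inj₂ (e , e∈E , InSpan-≡𝟘 ⊥ (⊕-self (φ e))) }

  module _ {N : MData n} (P : Presentation N) where
    open Presentation P
    open Circuits represents using (MinimalDep⇒circuit)

    flat-closed : ∀ {F g} → IsFlat N F → g ∈ E N → g ∉ F →
      ∀ Y → Y ⊆ F → ¬ InSpan K (φ g ⊕ colSum φ Y)
    flat-closed {F} {g} (F⊆E , flat) g∈E g∉F =
      size-induction (λ Y → Y ⊆ F → ¬ InSpan K (φ g ⊕ colSum φ Y)) step
      where
      step : ∀ Y → (∀ Y′ → ∣ Y′ ∣ < ∣ Y ∣ → Y′ ⊆ F → ¬ InSpan K (φ g ⊕ colSum φ Y′)) →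
        Y ⊆ F → ¬ InSpan K (φ g ⊕ colSum φ Y)
      step Y smaller Y⊆F sp = flat (Y ∪ ⁅ g ⁆) g Y+g-circuit g∈E g∉F (q⊆p∪q Y ⁅ g ⁆ (x∈⁅x⁆ g))
        (∪-least (λ i → p⊆p∪q ⁅ g ⁆ (Y⊆F i)) (q⊆p∪q F ⁅ g ⁆))
        where
        Y+g-circuit : IsCircuit N (Y ∪ ⁅ g ⁆)
        Y+g-circuit = MinimalDep⇒circuit (∪-least (λ i → F⊆E (Y⊆F i)) (x∈p⇒⁅x⁆⊆p g∈E))
          (smallest⇒MinimalDep (λ i → g∉F (Y⊆F i)) sp (λ Y′ lt Y′⊆Y → smaller Y′ lt (λ i → Y⊆F (Y′⊆Y i))))

    presentation-restrict : ∀ {F} → IsFlat N F → Presentation (restrict N F)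
    presentation-restrict {F} F-flat@(F⊆E , _) = record
      { K = K ; K⊆E = K⊆E ; E⊆E = λ i → E⊆E (F⊆E i)
      ; represents = RepresentsModulo-restrict represents F⊆E
      ; closed = F-closed }
      where
      F-closed : ClosedModulo K F
      F-closed e e∈E sp with closed e e∈E (InSpan-mono F∪K⊆ sp)
        where
        F∪K⊆ : F ∪ K ⊆ E N ∪ K
        F∪K⊆ = ∪-least (λ i → p⊆p∪q K (F⊆E i)) (q⊆p∪q (E N) K)
      ... | inj₁ e-loop = inj₁ e-loop
      ... | inj₂ (g , g∈E , e∥g) with g ∈? F
      ...   | yes g∈F = inj₂ (g , g∈F , e∥g)
      ...   | no  g∉F with InSpan-∪ F K (InSpan-cancel (F ∪ K) (InSpan-mono (q⊆p∪q F K) e∥g) sp)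
      ...     | Y , Y⊆F , spY = absurd (flat-closed F-flat g∈E g∉F Y Y⊆F spY)

  module _ {N : MData n} (P : Presentation N) {C : Subset n} (C⊆E : C ⊆ E N) where
    open Presentation P

    basis-spans : ∀ {B} → IsBasisOf N C B → ∀ {c} → c ∈ C → InSpan (B ∪ K) (φ c)
    basis-spans {B} (B⊆C , B-indep , maximal) {c} c∈C with c ∈? B
    ... | yes c∈B = InSpan-φ (B ∪ K) (p⊆p∪q K c∈B)
    ... | no  c∉B with IndepModulo⊎DepModulo K (B ∪ ⁅ c ⁆)
    ...   | inj₁ B+c-indep =
      absurd (maximal c c∈C c∉B (proj₂ (represents _ (∪-least B⊆E (x∈p⇒⁅x⁆⊆p (C⊆E c∈C)))) B+c-indep))
      where
      B⊆E : B ⊆ E N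
      B⊆E i = C⊆E (B⊆C i)
    ...   | inj₂ (Y , Y⊆B+c , spY , Y≢⊥) with c ∈? Y
    ...     | no c∉Y = absurd (Y≢⊥ (proj₁ (represents B (λ i → C⊆E (B⊆C i))) B-indep Y Y⊆B spY))
      where
      Y⊆B : Y ⊆ B
      Y⊆B i = x∈p∪⁅y⁆∧x≢y⇒x∈p (Y⊆B+c i) (λ { refl → c∉Y i })
    ...     | yes c∈Y = subst (InSpan (B ∪ K)) Σ≡
      (InSpan-⊕ (B ∪ K) (InSpan-mono (q⊆p∪q B K) spY) (InSpan-colSum Y-c⊆B∪K))
      where
      Y-c⊆B∪K : Y - c ⊆ B ∪ K
      Y-c⊆B∪K i = p⊆p∪q K (x∈p∪⁅y⁆∧x≢y⇒x∈p (Y⊆B+c (p-x⊆p Y i)) (x∈p-y⇒x≢y i))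
      Σ≡ : colSum φ Y ⊕ colSum φ (Y - c) ≡ φ c
      Σ≡ = trans (cong (_⊕ colSum φ (Y - c)) (sym (colSum-remove φ c∈Y))) (⊕-cancel-outer _ _)

    -- greedy extension; the fuel m bounds the number of remaining steps
    extend-to-basis : ∀ m B → n ≤ m + ∣ B ∣ → B ⊆ C → IndepModulo K B → ∃ λ B′ → IsBasisOf N C B′
    extend-to-basis m B bound B⊆C B-indep
      with any? (λ e → (e ∈? C) ×-dec ¬? (e ∈? B) ×-dec IndepModulo? K (B ∪ ⁅ e ⁆))
    ... | no none = B , B⊆C , proj₂ (represents B (λ i → C⊆E (B⊆C i))) B-indep , maximal
      where
      maximal : ∀ e → e ∈ C → e ∉ B → ¬ Indep N (B ∪ ⁅ e ⁆)
      maximal e e∈C e∉B i = none (e , e∈C , e∉B ,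
        proj₁ (represents _ (∪-least (λ j → C⊆E (B⊆C j)) (x∈p⇒⁅x⁆⊆p (C⊆E e∈C)))) i)
    ... | yes (e , e∈C , e∉B , B+e-indep) with m
    ...   | zero = absurd (n≮n ∣ B ∣ (≤-trans (subst (_≤ n) (∣p∪⁅x⁆∣≡1+∣p∣ B e e∉B) (∣p∣≤n (B ∪ ⁅ e ⁆))) bound))
    ...   | suc m = extend-to-basis m (B ∪ ⁅ e ⁆) bound′ (∪-least B⊆C (x∈p⇒⁅x⁆⊆p e∈C)) B+e-indep
      where
      bound′ : n ≤ m + ∣ B ∪ ⁅ e ⁆ ∣
      bound′ = subst (λ k → n ≤ m + k) (sym (∣p∪⁅x⁆∣≡1+∣p∣ B e e∉B))
                     (subst (n ≤_) (sym (+-suc m ∣ B ∣)) bound)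

    basis-exists : ∃ λ B → IsBasisOf N C B
    basis-exists = extend-to-basis n ⊥ (m≤m+n n _) (λ i → absurd (∉⊥ i))
                                   (λ Y Y⊆⊥ _ → ∉-everywhere⇒≡⊥ (λ i → ∉⊥ (Y⊆⊥ i)))

    basis-spans-K∪C : ∀ {B} → IsBasisOf N C B → ∀ {x} → x ∈ K ∪ C → InSpan (B ∪ K) (φ x)
    basis-spans-K∪C {B} B-basis i with x∈p∪q⁻ K C i
    ... | inj₁ a = InSpan-φ (B ∪ K) (q⊆p∪q B K a)
    ... | inj₂ b = basis-spans B-basis b

    module _ {X : Subset n} (X⊆E─C : X ⊆ E N ─ C) where

      private
        X∉C : ∀ {x} → x ∈ X → x ∉ C
        X∉C i = x∈p─q⇒x∉q (X⊆E─C i)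
        X∪B⊆E : ∀ {B} → B ⊆ C → X ∪ B ⊆ E N
        X∪B⊆E B⊆C = ∪-least (λ i → p─q⊆p (E N) C (X⊆E─C i)) (λ i → C⊆E (B⊆C i))

      contract-Indep⇒IndepModulo : Indep (contract N C) X → IndepModulo (K ∪ C) X
      contract-Indep⇒IndepModulo (_ , B , B-basis@(B⊆C , _) , X∪B-indep) Y Y⊆X sp
        with InSpan-∪ B K (InSpan-trans (basis-spans-K∪C B-basis) sp)
      ... | T , T⊆B , spY⊕T = ∉-everywhere⇒≡⊥ y∉Y
        where
        Y⊕T≡⊥ : Y ⊕ T ≡ ⊥
        Y⊕T≡⊥ = proj₁ (represents (X ∪ B) (X∪B⊆E B⊆C)) X∪B-indep (Y ⊕ T)
                  (⊕-least (λ i → p⊆p∪q B (Y⊆X i)) (λ i → q⊆p∪q X B (T⊆B i)))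
                  (subst (InSpan K) (sym (colSum-⊕ φ Y T)) spY⊕T)
        y∉Y : ∀ {y} → y ∉ Y
        y∉Y y∈Y = ∉⊥ (subst (_ ∈_) Y⊕T≡⊥
          (x∈p∧x∉q⇒x∈p⊕q y∈Y (λ y∈T → X∉C (Y⊆X y∈Y) (B⊆C (T⊆B y∈T)))))

      IndepModulo⇒contract-Indep : IndepModulo (K ∪ C) X → Indep (contract N C) X
      IndepModulo⇒contract-Indep X-indep with basis-exists
      ... | B , B-basis@(B⊆C , B-indep , _) =
        X⊆E─C , B , B-basis , proj₂ (represents (X ∪ B) (X∪B⊆E B⊆C)) X∪B-indep
        where
        X∪B-indep : IndepModulo K (X ∪ B)
        X∪B-indep Y Y⊆X∪B sp = proj₁ (represents B (λ i → C⊆E (B⊆C i))) B-indep Y Y⊆B sp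
          where
          Y─C⊆X : Y ─ C ⊆ X
          Y─C⊆X i with x∈p∪q⁻ X B (Y⊆X∪B (p─q⊆p Y C i))
          ... | inj₁ a = a
          ... | inj₂ b = absurd (x∈p─q⇒x∉q i (B⊆C b))
          Y─C≡⊥ : Y ─ C ≡ ⊥
          Y─C≡⊥ = X-indep (Y ─ C) Y─C⊆X (InSpan-─ K C sp)
          Y⊆B : Y ⊆ B
          Y⊆B {y} y∈Y with x∈p∪q⁻ X B (Y⊆X∪B y∈Y)
          ... | inj₂ y∈B = y∈B
          ... | inj₁ y∈X = absurd (∉⊥ (subst (y ∈_) Y─C≡⊥ (x∈p∧x∉q⇒x∈p─q y∈Y (X∉C y∈X))))

    contract-represents : RepresentsModulo (K ∪ C) (contract N C)
    contract-represents X X⊆E─C = contract-Indep⇒IndepModulo X⊆E─C , IndepModulo⇒contract-Indep X⊆E─C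

    module _ {S : Subset n} (simp : IsSimplificationSet (contract N C) S) where

      S⊆E─C : S ⊆ E N ─ C
      S⊆E─C = proj₁ simp

      S-covers : ∀ e → e ∈ E N ─ C → ¬ IsLoop (contract N C) e →
        e ∈ S ⊎ ∃ λ f → f ∈ S × Parallel (contract N C) e f
      S-covers = proj₂ (proj₂ (proj₂ simp))

      element-in-contraction : ∀ {g} → g ∈ E N →
        InSpan (K ∪ C) (φ g) ⊎ ∃ λ h → h ∈ S × InSpan (K ∪ C) (φ g ⊕ φ h)
      element-in-contraction {g} g∈E with g ∈? C
      ... | yes g∈C = inj₁ (InSpan-φ (K ∪ C) (q⊆p∪q K C g∈C))
      ... | no  g∉C with IndepModulo⊎DepModulo (K ∪ C) ⁅ g ⁆
      ...   | inj₂ g-dep = inj₁ (DepModulo-⁅⁆ g-dep)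
      ...   | inj₁ g-indep with S-covers g g∈E─C g-nonloop
        where
        g∈E─C : g ∈ E N ─ C
        g∈E─C = x∈p∧x∉q⇒x∈p─q g∈E g∉C
        g-nonloop : ¬ IsLoop (contract N C) g
        g-nonloop (_ , g-dep) = g-dep (proj₂ (contract-represents ⁅ g ⁆ (x∈p⇒⁅x⁆⊆p g∈E─C)) g-indep)
      ...     | inj₁ g∈S = inj₂ (g , g∈S , InSpan-≡𝟘 (K ∪ C) (⊕-self (φ g)))
      ...     | inj₂ (h , h∈S , g≢h , _ , h-nonloop , g∈E─C , h∈E─C , gh-dep)
        with IndepModulo⊎DepModulo (K ∪ C) (⁅ g ⁆ ∪ ⁅ h ⁆)
      ...       | inj₁ gh-indep =
        absurd (gh-dep (proj₂ (contract-represents _ (∪-least (x∈p⇒⁅x⁆⊆p g∈E─C) (x∈p⇒⁅x⁆⊆p h∈E─C))) gh-indep))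
      ...       | inj₂ gh-dep′ with DepModulo-pair g≢h gh-dep′
      ...         | inj₁ g-loop = inj₁ g-loop
      ...         | inj₂ (inj₂ g∥h) = inj₂ (h , h∈S , g∥h)
      ...         | inj₂ (inj₁ h-loop) = absurd (h-nonloop (h∈E─C , λ h-indep →
        IndepModulo-⁅⁆ (proj₁ (contract-represents ⁅ h ⁆ (x∈p⇒⁅x⁆⊆p h∈E─C)) h-indep) h-loop))

      contract-closed : ClosedModulo (K ∪ C) S
      contract-closed e e∈E sp with closed e e∈E (InSpan-mono S∪K∪C⊆ sp)
        where
        S∪K∪C⊆ : S ∪ (K ∪ C) ⊆ E N ∪ K
        S∪K∪C⊆ = ∪-least (λ i → p⊆p∪q K (p─q⊆p (E N) C (S⊆E─C i)))
                         (∪-least (q⊆p∪q (E N) K) (λ i → p⊆p∪q K (C⊆E i)))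
      ... | inj₁ e-loop = inj₁ (InSpan-mono (p⊆p∪q C) e-loop)
      ... | inj₂ (g , g∈E , e∥g) with element-in-contraction g∈E
      ...   | inj₁ g-loop = inj₁ (InSpan-cancelʳ (K ∪ C) (InSpan-mono (p⊆p∪q C) e∥g) g-loop)
      ...   | inj₂ (h , h∈S , g∥h) = inj₂ (h , h∈S ,
        subst (InSpan (K ∪ C)) (⊕-cancel-middle (φ e) (φ g) (φ h))
              (InSpan-⊕ (K ∪ C) (InSpan-mono (p⊆p∪q C) e∥g) g∥h))

      presentation-contract : Presentation (restrict (contract N C) S)
      presentation-contract = record
        { K = K ∪ C
        ; K⊆E = ∪-least K⊆E (λ i → E⊆E (C⊆E i))
        ; E⊆E = λ i → E⊆E (p─q⊆p (E N) C (S⊆E─C i))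
        ; represents = RepresentsModulo-restrict contract-represents S⊆E─C
        ; closed = contract-closed }

  presentation : ∀ {N} → InducedMinor M N → Presentation N
  presentation imRefl                         = presentation-refl
  presentation (imRestrict minor F F-flat)     = presentation-restrict (presentation minor) F-flat
  presentation (imContract minor C C⊆E S simp) = presentation-contract (presentation minor) C⊆E simp

  -- Lifting a four-element circuit of M / K to a circuit of M

  ProperlyIndependent : Subset n → Subset n → Set
  ProperlyIndependent K A = ∀ Y → Y ⊆ A → InSpan K (colSum φ Y) → Y ≡ ⊥ ⊎ Y ≡ A

  -- what the lifting argument uses of an induced U₃,₄ on A in M / K (not the dependence of A)
  record Quartet (K A : Subset n) : Set where
    field
      ∣A∣≡4    : ∣ A ∣ ≡ 4
      proper   : ProperlyIndependent K A
      A-closed : ClosedModulo K A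

  -- Z is a zero-sum set of M made of A and loops of M / K
  record Lift (K A Z : Subset n) : Set where
    field
      Z⊆E   : Z ⊆ E M
      Σ≡𝟘   : colSum φ Z ≡ 𝟘
      A⊆Z   : A ⊆ Z
      loops : ∀ {x} → x ∈ Z → x ∉ A → InSpan K (φ x)

  module _ {K : Subset n} where

    InSpan-outside : ∀ {A W} → (∀ {x} → x ∈ W → x ∉ A → InSpan K (φ x)) →
      InSpan K (colSum φ W ⊕ colSum φ (W ∩ A))
    InSpan-outside {A} {W} loops = subst (InSpan K) Σ≡ (InSpan-all K (W ─ (W ∩ A)) outside)
      where
      outside : ∀ {x} → x ∈ W ─ (W ∩ A) → InSpan K (φ x)
      outside {x} i = loops (p─q⊆p W (W ∩ A) i) (λ x∈A → x∈p─q⇒x∉q i (x∈p∩q⁺ (p─q⊆p W (W ∩ A) i , x∈A)))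
      Σ≡ : colSum φ (W ─ (W ∩ A)) ≡ colSum φ W ⊕ colSum φ (W ∩ A)
      Σ≡ = sym (trans (cong (_⊕ colSum φ (W ∩ A)) (trans (colSum-split φ (p∩q⊆p W A)) (⊕-comm _ _)))
                      (⊕-involutiveʳ _ _))

    -- a zero-sum W ⊆ Z meets A in ∅ or in A, so if W ≠ ∅, Z then Z ⊕ W, resp. W, is a smaller lift
    lift-circuit : ∀ {A Z} → Quartet K A → Lift K A Z → (∀ Z′ → ∣ Z′ ∣ < ∣ Z ∣ → ¬ Lift K A Z′) →
      IsCircuit M Z
    lift-circuit {A} {Z} Q L smaller =
      minimal-zeroSum⇒circuit Z⊆E (A⊆Z (proj₂ (size4⇒Nonempty ∣A∣≡4))) Σ≡𝟘 minimal
      where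
      open Quartet Q
      open Lift L
      minimal : ∀ W → W ⊆ Z → colSum φ W ≡ 𝟘 → W ≡ ⊥ ⊎ W ≡ Z
      minimal W W⊆Z ΣW≡𝟘 with proper (W ∩ A) (p∩q⊆q W A) spW∩A
        where
        spW∩A : InSpan K (colSum φ (W ∩ A))
        spW∩A = subst (InSpan K) (trans (cong (_⊕ colSum φ (W ∩ A)) ΣW≡𝟘) (⊕-identityˡ _))
                      (InSpan-outside (λ i → loops (W⊆Z i)))
      ... | inj₂ W∩A≡A with ⊆⊎∃∉ W Z
      ...   | inj₁ Z⊆W = inj₂ (⊆-antisym W⊆Z Z⊆W)
      ...   | inj₂ (x , x∈Z , x∉W) = absurd (smaller W (p⊆q∧x∉p⇒∣p∣<∣q∣ W⊆Z x∈Z x∉W) record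
        { Z⊆E = λ i → Z⊆E (W⊆Z i) ; Σ≡𝟘 = ΣW≡𝟘
        ; A⊆Z = λ i → p∩q⊆p W A (subst (_ ∈_) (sym W∩A≡A) i) ; loops = λ i → loops (W⊆Z i) })
      minimal W W⊆Z ΣW≡𝟘 | inj₁ W∩A≡⊥ with ≡⊥⊎Nonempty W
      ...   | inj₁ W≡⊥ = inj₁ W≡⊥
      ...   | inj₂ (w , w∈W) = absurd (smaller (Z ⊕ W) ∣Z⊕W∣<∣Z∣ record
        { Z⊆E = λ i → Z⊆E (Z⊕W⊆Z i)
        ; Σ≡𝟘 = trans (colSum-⊕ φ Z W) (trans (cong₂ _⊕_ Σ≡𝟘 ΣW≡𝟘) (⊕-self 𝟘))
        ; A⊆Z = λ a∈A → x∈p∧x∉q⇒x∈p⊕q (A⊆Z a∈A) (λ a∈W → ∉⊥ (subst (_ ∈_) W∩A≡⊥ (x∈p∩q⁺ (a∈W , a∈A))))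
        ; loops = λ i → loops (Z⊕W⊆Z i) })
        where
        Z⊕W⊆Z : Z ⊕ W ⊆ Z
        Z⊕W⊆Z = ⊕-least (λ i → i) W⊆Z
        ∣Z⊕W∣<∣Z∣ : ∣ Z ⊕ W ∣ < ∣ Z ∣
        ∣Z⊕W∣<∣Z∣ = p⊆q∧x∉p⇒∣p∣<∣q∣ Z⊕W⊆Z (W⊆Z w∈W) (x∈p∩q⇒x∉p⊕q (W⊆Z w∈W) w∈W)

    -- replacing g ∈ A by an element e parallel to it in M / K
    module Swap {A : Subset n} {g e : Fin n} (g∈A : g ∈ A) (e∉A : e ∉ A)
                (e∥g : InSpan K (φ e ⊕ φ g)) where

      A′ = (A - g) ∪ ⁅ e ⁆

      g≢e : g ≢ e
      g≢e g≡e = e∉A (subst (_∈ A) g≡e g∈A)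

      g∉A′ : g ∉ A′
      g∉A′ i = x∉p-x A (x∈p∪⁅y⁆∧x≢y⇒x∈p i g≢e)

      e∈A′ : e ∈ A′
      e∈A′ = q⊆p∪q (A - g) ⁅ e ⁆ (x∈⁅x⁆ e)

      ∈A′⁺ : ∀ {x} → x ∈ A → x ≢ g → x ∈ A′
      ∈A′⁺ x∈A x≢g = p⊆p∪q ⁅ e ⁆ (x∈p∧x≢y⇒x∈p-y x∈A x≢g)

      ∈A′⁻ : ∀ {x} → x ∈ A′ → x ≢ e → x ∈ A
      ∈A′⁻ i x≢e = p-x⊆p A (x∈p∪⁅y⁆∧x≢y⇒x∈p i x≢e)

      A′⊆ : ∀ {C} → e ∈ C → (∀ {x} → x ∈ A → x ≢ g → x ∈ C) → A′ ⊆ C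
      A′⊆ e∈C A-g⊆C = ∪-least (λ i → A-g⊆C (p-x⊆p A i) (x∈p-y⇒x≢y i)) (x∈p⇒⁅x⁆⊆p e∈C)

      swap-size : ∣ A ∣ ≡ 4 → ∣ A′ ∣ ≡ 4
      swap-size ∣A∣≡4 =
        trans (∣p∪⁅x⁆∣≡1+∣p∣ (A - g) e (λ i → e∉A (p-x⊆p A i))) (trans (sym (∣p∣≡1+∣p-x∣ g∈A)) ∣A∣≡4)

      -- a subset Y ∋ e of A′ corresponds to (Y - e) ∪ ⁅ g ⁆ ⊆ A, with the same sum modulo K
      swap-proper : ProperlyIndependent K A → ProperlyIndependent K A′
      swap-proper proper Y Y⊆A′ sp with e ∈? Y
      ... | no e∉Y with proper Y (λ i → ∈A′⁻ (Y⊆A′ i) (λ { refl → e∉Y i })) sp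
      ...   | inj₁ Y≡⊥ = inj₁ Y≡⊥
      ...   | inj₂ Y≡A = absurd (g∉A′ (Y⊆A′ (subst (g ∈_) (sym Y≡A) g∈A)))
      swap-proper proper Y Y⊆A′ sp | yes e∈Y
        with proper ((Y - e) ∪ ⁅ g ⁆) Y′⊆A (subst (InSpan K) Σ≡ (InSpan-⊕ K sp e∥g))
        where
        g∉Y-e : g ∉ Y - e
        g∉Y-e i = g∉A′ (Y⊆A′ (p-x⊆p Y i))
        Y′⊆A : (Y - e) ∪ ⁅ g ⁆ ⊆ A
        Y′⊆A = ∪-least (λ i → ∈A′⁻ (Y⊆A′ (p-x⊆p Y i)) (x∈p-y⇒x≢y i)) (x∈p⇒⁅x⁆⊆p g∈A)
        Σ≡ : colSum φ Y ⊕ (φ e ⊕ φ g) ≡ colSum φ ((Y - e) ∪ ⁅ g ⁆)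
        Σ≡ = begin
          colSum φ Y ⊕ (φ e ⊕ φ g)                ≡⟨ cong (_⊕ (φ e ⊕ φ g)) (sym (colSum-remove φ e∈Y)) ⟩
          (colSum φ (Y - e) ⊕ φ e) ⊕ (φ e ⊕ φ g)  ≡⟨ ⊕-cancel-middle _ _ _ ⟩
          colSum φ (Y - e) ⊕ φ g                  ≡⟨ sym (colSum-insert φ g∉Y-e) ⟩
          colSum φ ((Y - e) ∪ ⁅ g ⁆)              ∎
          where open ≡-Reasoning
      ... | inj₁ Y′≡⊥ = absurd (∉⊥ (subst (g ∈_) Y′≡⊥ (q⊆p∪q (Y - e) ⁅ g ⁆ (x∈⁅x⁆ g))))
      ... | inj₂ Y′≡A = inj₂ (⊆-antisym Y⊆A′ (A′⊆ e∈Y A-g⊆Y))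
        where
        A-g⊆Y : ∀ {x} → x ∈ A → x ≢ g → x ∈ Y
        A-g⊆Y {x} x∈A x≢g = p-x⊆p Y (x∈p∪⁅y⁆∧x≢y⇒x∈p (subst (x ∈_) (sym Y′≡A) x∈A) x≢g)

      swap-closed : ClosedModulo K A → ClosedModulo K A′
      swap-closed closed f f∈E sp with closed f f∈E (InSpan-trans generators sp)
        where
        generators : ∀ {x} → x ∈ A′ ∪ K → InSpan (A ∪ K) (φ x)
        generators {x} i with x∈p∪q⁻ A′ K i
        ... | inj₂ x∈K = InSpan-φ (A ∪ K) (q⊆p∪q A K x∈K)
        ... | inj₁ x∈A′ with x ≟ᶠ e
        ...   | no  x≢e = InSpan-φ (A ∪ K) (p⊆p∪q K (∈A′⁻ x∈A′ x≢e))
        ...   | yes refl = InSpan-cancelʳ (A ∪ K) (InSpan-mono (q⊆p∪q A K) e∥g)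
                                          (InSpan-φ (A ∪ K) (p⊆p∪q K g∈A))
      ... | inj₁ f-loop = inj₁ f-loop
      ... | inj₂ (h , h∈A , f∥h) with h ≟ᶠ g
      ...   | no  h≢g = inj₂ (h , ∈A′⁺ h∈A h≢g , f∥h)
      ...   | yes refl = inj₂ (e , e∈A′ , subst (InSpan K) (⊕-cancel-middle (φ f) (φ h) (φ e))
                                              (InSpan-⊕ K f∥h (subst (InSpan K) (⊕-comm (φ e) (φ h)) e∥g)))

      Quartet-swap : Quartet K A → Quartet K A′
      Quartet-swap Q = record
        { ∣A∣≡4 = swap-size ∣A∣≡4 ; proper = swap-proper proper ; A-closed = swap-closed A-closed }
        where open Quartet Q

    SmallerLift : Subset n → Set
    SmallerLift Z = ∃ λ A′ → ∃ λ C → ∣ C ∣ < ∣ Z ∣ × Quartet K A′ × Lift K A′ C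

    module SplitLift {A Z : Subset n} (Q : Quartet K A) (L : Lift K A Z)
                     {C₁ C₂ : Subset n} {e : Fin n} (c₁ : IsCircuit M C₁) (c₂ : IsCircuit M C₂)
                     (C₁∩C₂≡e : C₁ ∩ C₂ ≡ ⁅ e ⁆) (Z≡ : Z ≡ (C₁ ∪ C₂) - e) where

      open Quartet Q
      open Lift L

      e∈C₁∩C₂ : e ∈ C₁ ∩ C₂
      e∈C₁∩C₂ = subst (e ∈_) (sym C₁∩C₂≡e) (x∈⁅x⁆ e)

      ∈C₁∩C₂⇒≡e : ∀ {x} → x ∈ C₁ → x ∈ C₂ → x ≡ e
      ∈C₁∩C₂⇒≡e x∈C₁ x∈C₂ = x∈⁅y⁆⇒x≡y _ (subst (_ ∈_) C₁∩C₂≡e (x∈p∩q⁺ (x∈C₁ , x∈C₂)))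

      ∈Z⁺ : ∀ {x} → x ∈ C₁ ∪ C₂ → x ≢ e → x ∈ Z
      ∈Z⁺ i x≢e = subst (_ ∈_) (sym Z≡) (x∈p∧x≢y⇒x∈p-y i x≢e)

      ∈Z⁻ : ∀ {x} → x ∈ Z → (x ∈ C₁ ⊎ x ∈ C₂) × x ≢ e
      ∈Z⁻ i = x∈p∪q⁻ C₁ C₂ (p-x⊆p (C₁ ∪ C₂) i′) , x∈p-y⇒x≢y i′
        where i′ = subst (_ ∈_) Z≡ i

      e∉A : e ∉ A
      e∉A e∈A = proj₂ (∈Z⁻ (A⊆Z e∈A)) refl

      record Side (C O : Subset n) : Set where
        field
          C-circ : IsCircuit M C
          O-circ : IsCircuit M O
          e∈C    : e ∈ C
          e∈O    : e ∈ O
          C∩O    : ∀ {x} → x ∈ C → x ∈ O → x ≡ e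
          C⊆Z    : ∀ {x} → x ∈ C → x ≢ e → x ∈ Z
          O⊆Z    : ∀ {x} → x ∈ O → x ≢ e → x ∈ Z

      side₁ : Side C₁ C₂
      side₁ = record { C-circ = c₁ ; O-circ = c₂ ; C∩O = ∈C₁∩C₂⇒≡e
                     ; e∈C = p∩q⊆p C₁ C₂ e∈C₁∩C₂ ; e∈O = p∩q⊆q C₁ C₂ e∈C₁∩C₂
                     ; C⊆Z = λ i → ∈Z⁺ (p⊆p∪q C₂ i) ; O⊆Z = λ i → ∈Z⁺ (q⊆p∪q C₁ C₂ i) }

      side₂ : Side C₂ C₁
      side₂ = record { C-circ = c₂ ; O-circ = c₁ ; C∩O = λ a b → ∈C₁∩C₂⇒≡e b a
                     ; e∈C = p∩q⊆q C₁ C₂ e∈C₁∩C₂ ; e∈O = p∩q⊆p C₁ C₂ e∈C₁∩C₂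
                     ; C⊆Z = λ i → ∈Z⁺ (q⊆p∪q C₁ C₂ i) ; O⊆Z = λ i → ∈Z⁺ (p⊆p∪q C₂ i) }

      -- the other circuit contributes at least two elements of Z outside C
      side-smaller : ∀ {C O} → Side C O → ∣ C ∣ < ∣ Z ∣
      side-smaller {C} {O} S with circuit-two-others O-circ e∈O
        where open Side S
      ... | y , y′ , y∈O , y′∈O , y≢e , y′≢e , y≢y′ =
        subst (λ k → suc k ≤ ∣ Z ∣) (sym (∣p∣≡1+∣p-x∣ e∈C))
          (2+∣p∣≤∣q∣ {p = C - e} (λ i → C⊆Z (p-x⊆p C i) (x∈p-y⇒x≢y i)) (O⊆Z y∈O y≢e) (O⊆Z y′∈O y′≢e)
                     (λ i → y≢e (C∩O (p-x⊆p C i) y∈O)) (λ i → y′≢e (C∩O (p-x⊆p C i) y′∈O)) y≢y′)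
        where open Side S

      side-lift : ∀ {C O A′} → Side C O → A′ ⊆ C → Quartet K A′ → (e ∉ A′ → InSpan K (φ e)) →
        (∀ {x} → x ∈ C → x ≢ e → x ∈ A → x ∈ A′) → SmallerLift Z
      side-lift {C} {O} {A′} S A′⊆C Q′ e-loop A⇒A′ = A′ , C , side-smaller S , Q′ , record
        { Z⊆E = proj₁ C-circ ; Σ≡𝟘 = circuit-colSum C-circ ; A⊆Z = A′⊆C ; loops = loops′ }
        where
        open Side S
        loops′ : ∀ {x} → x ∈ C → x ∉ A′ → InSpan K (φ x)
        loops′ {x} x∈C x∉A′ with x ≟ᶠ e
        ... | yes refl = e-loop x∉A′
        ... | no  x≢e  = loops (C⊆Z x∈C x≢e) (λ x∈A → x∉A′ (A⇒A′ x∈C x≢e x∈A))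

      P = (C₁ - e) ∩ A

      ∈P⁺ : ∀ {x} → x ∈ C₁ → x ≢ e → x ∈ A → x ∈ P
      ∈P⁺ x∈C₁ x≢e x∈A = x∈p∩q⁺ (x∈p∧x≢y⇒x∈p-y x∈C₁ x≢e , x∈A)

      ∈P⁻ : ∀ {x} → x ∈ P → x ∈ C₁
      ∈P⁻ i = p-x⊆p C₁ (p∩q⊆p (C₁ - e) A i)

      ∉P⇒∈C₂ : ∀ {x} → x ∈ A → x ∉ P → x ∈ C₂
      ∉P⇒∈C₂ {x} x∈A x∉P with ∈Z⁻ (A⊆Z x∈A)
      ... | inj₁ x∈C₁ , x≢e = absurd (x∉P (∈P⁺ x∈C₁ x≢e x∈A))
      ... | inj₂ x∈C₂ , _   = x∈C₂

      -- e is spanned by the rest of C₁, whose elements outside P are loops of M / K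
      spP : InSpan K (φ e ⊕ colSum φ P)
      spP = subst (InSpan K) (cong (_⊕ colSum φ P) Σ≡φe)
                  (InSpan-outside (λ i → loops (Side.C⊆Z side₁ (p-x⊆p C₁ i) (x∈p-y⇒x≢y i))))
        where
        Σ≡φe : colSum φ (C₁ - e) ≡ φ e
        Σ≡φe = ⊕≡𝟘⇒≡ _ _ (trans (colSum-remove φ (Side.e∈C side₁)) (circuit-colSum c₁))

      φe∈span : InSpan (A ∪ K) (φ e)
      φe∈span = InSpan-cancelʳ (A ∪ K) (InSpan-mono (q⊆p∪q A K) spP)
                  (InSpan-colSum (λ i → p⊆p∪q K (p∩q⊆q (C₁ - e) A i)))

      swap-into-C₂ : ∀ {g} → g ∈ A → InSpan K (φ e ⊕ φ g) → P ⊕ ⁅ g ⁆ ≡ ⊥ → SmallerLift Z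
      swap-into-C₂ {g} g∈A e∥g P⊕g≡⊥ =
        side-lift side₂ (A′⊆ (Side.e∈C side₂) (λ x∈A x≢g → ∉P⇒∈C₂ x∈A (∉P x≢g)))
                  (Quartet-swap Q) (λ e∉A′ → absurd (e∉A′ e∈A′)) A⇒A′
        where
        open Swap g∈A e∉A e∥g
        ∉P : ∀ {x} → x ≢ g → x ∉ P
        ∉P x≢g x∈P = ∉⊥ (subst (_ ∈_) P⊕g≡⊥ (x∈p∧x∉q⇒x∈p⊕q x∈P (x≢y⇒x∉⁅y⁆ x≢g)))
        g∈P : g ∈ P
        g∈P with g ∈? P
        ... | yes g∈P = g∈P
        ... | no  g∉P = absurd (∉⊥ (subst (g ∈_) P⊕g≡⊥ (x∉p∧x∈q⇒x∈p⊕q g∉P (x∈⁅x⁆ g))))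
        A⇒A′ : ∀ {x} → x ∈ C₂ → x ≢ e → x ∈ A → x ∈ A′
        A⇒A′ x∈C₂ x≢e x∈A = ∈A′⁺ x∈A (λ { refl → x≢e (∈C₁∩C₂⇒≡e (∈P⁻ g∈P) x∈C₂) })

      swap-into-C₁ : ∀ {g} → g ∈ A → InSpan K (φ e ⊕ φ g) → P ⊕ ⁅ g ⁆ ≡ A → SmallerLift Z
      swap-into-C₁ {g} g∈A e∥g P⊕g≡A =
        side-lift side₁ (A′⊆ (Side.e∈C side₁) (λ x∈A x≢g → ∈P⁻ (∈P x∈A x≢g)))
                  (Quartet-swap Q) (λ e∉A′ → absurd (e∉A′ e∈A′)) A⇒A′
        where
        open Swap g∈A e∉A e∥g
        ∈P : ∀ {x} → x ∈ A → x ≢ g → x ∈ P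
        ∈P x∈A x≢g with x∈p⊕q⁻ P ⁅ g ⁆ (subst (_ ∈_) (sym P⊕g≡A) x∈A)
        ... | inj₁ (x∈P , _) = x∈P
        ... | inj₂ (_ , x∈g) = absurd (x≢g (x∈⁅y⁆⇒x≡y g x∈g))
        g∉P : g ∉ P
        g∉P g∈P = x∈p∩q⇒x∉p⊕q g∈P (x∈⁅x⁆ g) (subst (g ∈_) (sym P⊕g≡A) g∈A)
        A⇒A′ : ∀ {x} → x ∈ C₁ → x ≢ e → x ∈ A → x ∈ A′
        A⇒A′ x∈C₁ x≢e x∈A = ∈A′⁺ x∈A (λ { refl → g∉P (∈P⁺ x∈C₁ x≢e x∈A) })

      smaller-lift : SmallerLift Z
      smaller-lift with A-closed e (proj₁ c₁ (Side.e∈C side₁)) φe∈span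
      ... | inj₁ e-loop with proper P (p∩q⊆q (C₁ - e) A) (InSpan-cancel K spP e-loop)
      ...   | inj₁ P≡⊥ = side-lift side₂ (λ x∈A → ∉P⇒∈C₂ x∈A (λ x∈P → ∉⊥ (subst (_ ∈_) P≡⊥ x∈P)))
                                   Q (λ _ → e-loop) (λ _ _ x∈A → x∈A)
      ...   | inj₂ P≡A = side-lift side₁ (λ x∈A → ∈P⁻ (subst (_ ∈_) (sym P≡A) x∈A))
                                   Q (λ _ → e-loop) (λ _ _ x∈A → x∈A)
      smaller-lift | inj₂ (g , g∈A , e∥g) with proper (P ⊕ ⁅ g ⁆) P⊕g⊆A spP⊕g
        where
        P⊕g⊆A : P ⊕ ⁅ g ⁆ ⊆ A
        P⊕g⊆A i with x∈p⊕q⁻ P ⁅ g ⁆ i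
        ... | inj₁ (x∈P , _) = p∩q⊆q (C₁ - e) A x∈P
        ... | inj₂ (_ , x∈g) = x∈p⇒⁅x⁆⊆p g∈A x∈g
        spP⊕g : InSpan K (colSum φ (P ⊕ ⁅ g ⁆))
        spP⊕g = subst (InSpan K) Σ≡ (InSpan-⊕ K e∥g spP)
          where
          Σ≡ : (φ e ⊕ φ g) ⊕ (φ e ⊕ colSum φ P) ≡ colSum φ (P ⊕ ⁅ g ⁆)
          Σ≡ = begin
            (φ e ⊕ φ g) ⊕ (φ e ⊕ colSum φ P)  ≡⟨ sym (⊕-absorb-common (φ e) (φ g) (colSum φ P)) ⟩
            φ g ⊕ colSum φ P                  ≡⟨ ⊕-comm (φ g) (colSum φ P) ⟩
            colSum φ P ⊕ φ g                  ≡⟨ cong (colSum φ P ⊕_) (sym (colSum-⁅⁆ φ g)) ⟩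
            colSum φ P ⊕ colSum φ ⁅ g ⁆       ≡⟨ sym (colSum-⊕ φ P ⁅ g ⁆) ⟩
            colSum φ (P ⊕ ⁅ g ⁆)              ∎
            where open ≡-Reasoning
      ... | inj₁ P⊕g≡⊥ = swap-into-C₂ g∈A e∥g P⊕g≡⊥
      ... | inj₂ P⊕g≡A = swap-into-C₁ g∈A e∥g P⊕g≡A

    chordal⇒no-lift : IsChordal M → ∀ Z {A} → Quartet K A → ¬ Lift K A Z
    chordal⇒no-lift chordal = size-induction (λ Z → ∀ {A} → Quartet K A → ¬ Lift K A Z) step
      where
      step : ∀ Z → (∀ Z′ → ∣ Z′ ∣ < ∣ Z ∣ → ∀ {A} → Quartet K A → ¬ Lift K A Z′) →
        ∀ {A} → Quartet K A → ¬ Lift K A Z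
      step Z smaller Q L with chordal Z (lift-circuit Q L (λ Z′ lt → smaller Z′ lt Q))
                                   (subst (_≤ ∣ Z ∣) (Quartet.∣A∣≡4 Q) (p⊆q⇒∣p∣≤∣q∣ (Lift.A⊆Z L)))
      ... | C₁ , C₂ , e , c₁ , c₂ , C₁∩C₂≡e , Z≡ with SplitLift.smaller-lift Q L c₁ c₂ C₁∩C₂≡e Z≡
      ...   | A′ , C , ∣C∣<∣Z∣ , Q′ , L′ = smaller C ∣C∣<∣Z∣ Q′ L′

  module _ {N : MData n} (P : Presentation N) (N-U34 : IsU34 N) where
    open Presentation P

    private
      ∣A∣≡4 = proj₁ N-U34
      U34 = proj₂ N-U34

    U34-proper : ProperlyIndependent K (E N)
    U34-proper Y Y⊆A sp with ∣ Y ∣ ≤? 3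
    ... | yes ∣Y∣≤3 = inj₁ (proj₁ (represents Y Y⊆A) (proj₂ (U34 Y Y⊆A) ∣Y∣≤3) Y (λ i → i) sp)
    ... | no  ∣Y∣≰3 = inj₂ (p⊆q∧∣q∣≤∣p∣⇒p≡q Y⊆A (subst (_≤ ∣ Y ∣) (sym ∣A∣≡4) (≰⇒> ∣Y∣≰3)))

    U34-dependent : InSpan K (colSum φ (E N))
    U34-dependent with IndepModulo⊎DepModulo K (E N)
    ... | inj₁ A-indep = absurd (n≮n 3 (subst (_≤ 3) ∣A∣≡4
                           (proj₁ (U34 (E N) (λ i → i)) (proj₂ (represents (E N) (λ i → i)) A-indep))))
    ... | inj₂ (Y , Y⊆A , sp , Y≢⊥) with U34-proper Y Y⊆A sp
    ...   | inj₁ Y≡⊥ = absurd (Y≢⊥ Y≡⊥)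
    ...   | inj₂ Y≡A = subst (λ W → InSpan K (colSum φ W)) Y≡A sp

    -- A = E N is lifted by adding a set T ⊆ K with the same column sum
    U34-lift : ∃ λ Z → Quartet K (E N) × Lift K (E N) Z
    U34-lift with U34-dependent
    ... | T , T⊆K , ΣT≡ΣA = E N ⊕ T , record { ∣A∣≡4 = ∣A∣≡4 ; proper = U34-proper ; A-closed = closed } , record
      { Z⊆E = ⊕-least E⊆E (λ i → K⊆E (T⊆K i))
      ; Σ≡𝟘 = trans (colSum-⊕ φ (E N) T) (trans (cong (colSum φ (E N) ⊕_) ΣT≡ΣA) (⊕-self _))
      ; A⊆Z = λ a∈A → x∈p∧x∉q⇒x∈p⊕q a∈A (A∉T a∈A)
      ; loops = loops }
      where
      A∉T : ∀ {x} → x ∈ E N → x ∉ T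
      A∉T {x} x∈A x∈T with U34-proper ⁅ x ⁆ (x∈p⇒⁅x⁆⊆p x∈A)
                             (subst (InSpan K) (sym (colSum-⁅⁆ φ x)) (InSpan-φ K (T⊆K x∈T)))
      ... | inj₁ x≡⊥ = ∉⊥ (subst (x ∈_) x≡⊥ (x∈⁅x⁆ x))
      ... | inj₂ x≡A with trans (sym (∣⁅x⁆∣≡1 x)) (trans (cong ∣_∣ x≡A) ∣A∣≡4)
      ...   | ()
      loops : ∀ {x} → x ∈ E N ⊕ T → x ∉ E N → InSpan K (φ x)
      loops i x∉A with x∈p⊕q⁻ (E N) T i
      ... | inj₁ (x∈A , _) = absurd (x∉A x∈A)
      ... | inj₂ (_ , x∈T) = InSpan-φ K (T⊆K x∈T)

  chordal⇒no-induced-U34 : IsChordal M → ¬ ∃ λ N → InducedMinor M N × IsU34 N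
  chordal⇒no-induced-U34 chordal (N , N-minor , N-U34) with U34-lift (presentation N-minor) N-U34
  ... | Z , Q , L = chordal⇒no-lift chordal Z Q L

lemma3p8 : (n : ℕ) (M : MData n) → IsMatroid M → IsBinary M → IsSimple M →
    (IsChordal M ⇔ (¬ ∃ λ N → InducedMinor M N × IsU34 N))
lemma3p8 n M isM (r , φ , rep) simple = mk⇔ chordal⇒no-induced-U34 no-induced-U34⇒chordal
  where open SimpleBinary isM rep simple
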